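{- Consider a $k$-Median instance with optimal solution $\mathrm{OPT}$ ($|\mathrm{OPT}|=k$, $\mathrm{opt}=d(\mathrm{OPT})$), a uniform opening cost $\lambda\ge 0$, and a parameter $\delta\in(0,1/2]$. Let $S_2\subseteq F$ with $k_2=|S_2|>k$ be a local optimum of local search (with respect to swaps $(A,B)$, $A\subseteq S_2$, $B\subseteq F$, $|A|,|B|\le\Delta$ for some integer $\Delta\ge1$) for the UFL instance with uniform opening cost $\lambda$. Then $$\lambda k_2^L\le\Big(\frac{2}{\delta}(1-\alpha^{MM})+2\frac{1-\delta}{\delta}(\beta_2-\beta_2^{MM})+2\frac{\delta}{1-\delta}(\beta_2^{MM}+\alpha^{MM})\Big)\cdot\mathrm{opt}.$$
   Context: Clients $C$, facilities $F$, metric $dist$; $d(S)=\sum_{j\in C}\min_{f\in S}dist(j,f)$; the UFL cost of $S$ with uniform opening cost $\lambda$ is $\lambda|S|+d(S)$; a local optimum $S_2$ is one for which no $S_2\setminus A\cup B$ with $|A|,|B|\le\Delta$ has strictly smaller UFL cost. Each client is served by a closest facility of the solution; $C_S(f)$ is the set of clients served by $f$ in $S$. For $\alpha\ge1/2$, $f\in S$ $\alpha$-captures $f'\in S'$ if $|C_S(f)\cap C_{S'}(f')|>\alpha|C_{S'}(f')|$; a set $X\subseteq S$ $\alpha$-captures $f'$ if more than an $\alpha$ fraction of $C_{S'}(f')$ is served in $S$ by facilities of $X$. Matching: for each $f'\in S_2$, let $M(f')$ be the set of facilities of $\mathrm{OPT}$ that are $(1-\delta)$-captured by $f'$ (clients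 of $S_2$ vs. clients of $\mathrm{OPT}$); if $M(f')$ $1/2$-captures $f'$, then $f'$ and the facilities of $M(f')$ are matched; all other facilities are lonely. $S_2^L$ is the set of lonely facilities of $S_2$ and $k_2^L=|S_2^L|$. Let $d_2=d(S_2)$, $\beta_2=d_2/\mathrm{opt}$; $\mathrm{opt}^{MM}$ (resp. $d_2^{MM}$) is the connection cost in $\mathrm{OPT}$ (resp. in $S_2$) of the clients served by matched facilities both in $S_2$ and in $\mathrm{OPT}$; $\alpha^{MM}=\mathrm{opt}^{MM}/\mathrm{opt}$, $\beta_2^{MM}=d_2^{MM}/\mathrm{opt}$.
   Formalization: The metric $dist$ takes rational values, and the opening cost $\lambda$ and the parameter $\delta$ are rational numbers. -}

module Defs where

open import Data.Nat as ℕ using (ℕ; zero; suc)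
open import Data.Integer using (+_)
open import Data.Fin using (Fin)
import Data.Fin as Fin
open import Data.Fin.Subset using (Subset; _∈_; _⊆_; _∪_; _─_; ∣_∣)
open import Data.Fin.Subset.Properties using (_∈?_)
open import Data.Sum using (_⊎_; inj₁; inj₂)
open import Data.Product using (_×_)
open import Data.Bool using (Bool; true; false; _∧_; _∨_; not; if_then_else_)
open import Data.Rational as ℚ using (ℚ; 0ℚ; 1ℚ; ½; _+_; _*_; _-_; _<_; _≤_; _÷_)
open import Data.Rational.Properties using (_<?_; _≟_)
open import Relation.Nullary using (¬_; yes; no; does)
open import Relation.Binary.PropositionalEquality using (_≡_)
open import Function using (_∘_)

sumFin : ∀ {n} → (Fin n → ℚ) → ℚ
sumFin {zero}  f = 0ℚ
sumFin {suc n} f = f Fin.zero + sumFin (f ∘ Fin.suc)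

countFin : ∀ {n} → (Fin n → Bool) → ℕ
countFin {zero}  P = 0
countFin {suc n} P = (if P Fin.zero then 1 else 0) ℕ.+ countFin (P ∘ Fin.suc)

anyFin : ∀ {n} → (Fin n → Bool) → Bool
anyFin {zero}  P = false
anyFin {suc n} P = P Fin.zero ∨ anyFin (P ∘ Fin.suc)

toℚ : ℕ → ℚ
toℚ n = + n ℚ./ 1

-- Total division on ℚ (x / 0 := 0); only used with nonzero denominators.
_/ℚ_ : ℚ → ℚ → ℚ
x /ℚ y with y ≟ 0ℚ
... | yes _  = 0ℚ
... | no y≢0 = _÷_ x y {{ℚ.≢-nonZero y≢0}}

_==_ : ∀ {n} → Fin n → Fin n → Bool
i == j = does (i Fin.≟ j)

_<ᵇ_ : ℚ → ℚ → Bool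
x <ᵇ y = does (x <? y)

-- Instances: clients Fin m, facilities Fin p; points are C ⊎ F.

Point : ℕ → ℕ → Set
Point m p = Fin m ⊎ Fin p

record IsMetric {A : Set} (dist : A → A → ℚ) : Set where
  field
    dist-refl  : ∀ x → dist x x ≡ 0ℚ
    dist-nonneg : ∀ x y → 0ℚ ≤ dist x y
    dist-sym   : ∀ x y → dist x y ≡ dist y x
    dist-tri   : ∀ x y z → dist x z ≤ dist x y + dist y z

module Instance {m p : ℕ} (dist : Point m p → Point m p → ℚ) where

  cdist : Fin m → Fin p → ℚ
  cdist j f = dist (inj₁ j) (inj₂ f)

  -- σ assigns every client to a closest facility of the solution S
  -- (so C_S(f) = { j | σ j = f }).
  Closest : Subset p → (Fin m → Fin p) → Set
  Closest S σ = ∀ j → (σ j ∈ S) × (∀ f → f ∈ S → cdist j (σ j) ≤ cdist j f)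

  -- d(S) computed through a closest assignment σ of S
  connCost : (Fin m → Fin p) → ℚ
  connCost σ = sumFin (λ j → cdist j (σ j))

  uflCost : ℚ → Subset p → (Fin m → Fin p) → ℚ
  uflCost lam S σ = lam * toℚ ∣ S ∣ + connCost σ

  KMedianOpt : ℕ → Subset p → (Fin m → Fin p) → Set
  KMedianOpt k OPT σO =
    (∣ OPT ∣ ≡ k) × Closest OPT σO ×
    (∀ (S : Subset p) (σ : Fin m → Fin p) → ∣ S ∣ ℕ.≤ k → Closest S σ →
       connCost σO ≤ connCost σ)

  LocalOpt : ℕ → ℚ → Subset p → (Fin m → Fin p) → Set
  LocalOpt Δ lam S2 σ2 =
    ∀ (A B : Subset p) → A ⊆ S2 → ∣ A ∣ ℕ.≤ Δ → ∣ B ∣ ℕ.≤ Δ →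
    ∀ (σ' : Fin m → Fin p) → Closest ((S2 ─ A) ∪ B) σ' →
    ¬ (uflCost lam ((S2 ─ A) ∪ B) σ' < uflCost lam S2 σ2)

  captures : ℚ → (Fin m → Fin p) → Fin p → (Fin m → Fin p) → Fin p → Bool
  captures α σS f σS' f' =
    (α * toℚ (countFin (λ j → σS' j == f')))
      <ᵇ toℚ (countFin (λ j → (σS j == f) ∧ (σS' j == f')))

  setCaptures : ℚ → (Fin m → Fin p) → (Fin p → Bool) → (Fin m → Fin p) → Fin p → Bool
  setCaptures α σS X σS' f' =
    (α * toℚ (countFin (λ j → σS' j == f')))
      <ᵇ toℚ (countFin (λ j → X (σS j) ∧ (σS' j == f')))

  module Matching (δ : ℚ) (OPT : Subset p) (σO : Fin m → Fin p)
                  (S2 : Subset p) (σ2 : Fin m → Fin p) where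

    inM : Fin p → Fin p → Bool
    inM f' o = does (o ∈? OPT) ∧ captures (1ℚ - δ) σ2 f' σO o

    matched2 : Fin p → Bool
    matched2 f' = does (f' ∈? S2) ∧ setCaptures ½ σO (inM f') σ2 f'

    matchedO : Fin p → Bool
    matchedO o = does (o ∈? OPT) ∧ anyFin (λ f' → matched2 f' ∧ inM f' o)

    lonely2 : Fin p → Bool
    lonely2 f' = does (f' ∈? S2) ∧ not (matched2 f')

    k2L : ℕ
    k2L = countFin lonely2

    mmClient : Fin m → Bool
    mmClient j = matched2 (σ2 j) ∧ matchedO (σO j)

    optMM : ℚ
    optMM = sumFin (λ j → if mmClient j then cdist j (σO j) else 0ℚ)

    d2MM : ℚ
    d2MM = sumFin (λ j → if mmClient j then cdist j (σ2 j) else 0ℚ)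

-- A lonely facility f of S2 can be closed, so local optimality bounds λ by the total
-- increase ("extra") of the connection costs of f's clients when they move to their next
-- closest facility of S2. As f does not ½-capture itself, its clients whose OPT facility f
-- captures are at most as many as the remaining ("free") ones, and the triangle inequality
-- through f bounds the extra of each of the former by that of any free client plus twice
-- its cost; hence λ k₂ᴸ is at most twice the reassignment cost of the free lonely clients.
-- A free client j of o ∈ OPT is sent through o to the facility of another client i of o,
-- at cost d(j,o) + d(i,o) + d(i,S2). If o is matched, the matched facility that
-- (1-δ)-captures o serves no free client, and averaging over its clients of o costs a
-- factor δ/(1-δ). If o is lonely, let i* be the client of o with the cheapest route;
-- free clients of o away from the facility of i* go through i*, those at it are averaged
-- over the clients of o elsewhere, which are at least a δ-fraction of o's clients because
-- that facility does not (1-δ)-capture o; this costs a factor (1-δ)/δ.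

module Submission where

open import Defs
open import Data.Nat using (ℕ) renaming (_≤_ to _≤ℕ_; _<_ to _<ℕ_)
open import Data.Fin using (Fin)
open import Data.Fin.Subset using (Subset; ∣_∣)
open import Data.Rational using (ℚ; 0ℚ; 1ℚ; ½; _+_; _*_; _-_; _<_; _≤_)

open import Algebra.Bundles using (CommutativeRing)
import Algebra.Properties.Semiring.Sum as SemiringSum
open import Data.Bool using (Bool; true; false; T; _∧_; not; if_then_else_)
open import Data.Bool.Properties using (T-≡; T-∨; T?; ∧-comm)
open import Data.Empty using (⊥-elim)
open import Data.Fin using (zero; suc)
import Data.Fin.Properties as Fin
open import Data.Fin.Subset using (_∈_; _⊆_; _∪_; _─_; ⁅_⁆; ⊥; Nonempty)
open import Data.Fin.Subset.Properties
  using (_∈?_; nonempty?; x∈p∧x≢y⇒x∈p-y; x∈⁅x⁆; x∈⁅y⁆⇒x≡y; ∣⁅x⁆∣≡1; ∣⊥∣≡0; p⊆q⇒∣p∣≤∣q∣;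
         p─q⊆p; x∈p⇒∣p-x∣<∣p∣; ∪-identityʳ)
import Data.Integer as ℤ
import Data.Integer.Properties as ℤ
open import Data.List using (filter; allFin)
open import Data.List.Membership.Propositional.Properties using (∈-filter⁺; ∈-allFin)
open import Data.List.Relation.Unary.All using (lookup)
open import Data.List.Relation.Unary.All.Properties using (all-filter)
import Data.Nat as ℕ
import Data.Nat.Coprimality as Coprime
import Data.Nat.Properties as ℕ
open import Data.Product using (∃-syntax; _×_; _,_; proj₁; proj₂)
open import Data.Rational as ℚ using (mkℚ; -_; nonNegative; positive)
open import Data.Rational.Properties as ℚ
  using (≤-refl; ≤-trans; ≤-reflexive; <⇒≤; ≮⇒≥; ≰⇒>; +-mono-≤; *-comm; module ≤-Reasoning)
open import Data.Rational.Solver using (module +-*-Solver)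
open +-*-Solver using (solve; _:+_; _:-_; _:*_; con; _:=_)
import Data.Rational.Unnormalised as ℚᵘ
import Data.Rational.Unnormalised.Properties as ℚᵘ
open import Data.Sum using (inj₁; inj₂; [_,_]′)
open import Function using (_∘_; Equivalence)
open import Relation.Binary.Bundles using (DecTotalOrder)
open import Relation.Binary.PropositionalEquality
  using (_≡_; _≢_; refl; sym; trans; cong; cong₂; subst; subst₂; module ≡-Reasoning)
open import Relation.Nullary using (¬_; Dec; yes; no; does)
open import Relation.Nullary.Decidable using (toSum)
open import Relation.Unary using (Pred; Decidable)
open import Data.List.Extrema (DecTotalOrder.totalOrder ℚ.≤-decTotalOrder)
  using (argmin; argmin-all; f[argmin]≤f[xs])

private
  variable
    n : ℕ

-- Ordered-field facts about ℚ

0≤q-p⇒p≤q : ∀ {x y} → 0ℚ ≤ y - x → x ≤ y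
0≤q-p⇒p≤q {x} {y} 0≤y-x = begin
  x             ≡⟨ sym (ℚ.+-identityˡ x) ⟩
  0ℚ + x        ≤⟨ ℚ.+-monoˡ-≤ x 0≤y-x ⟩
  (y - x) + x   ≡⟨ y-x+x≡y y x ⟩
  y             ∎
  where
  open ≤-Reasoning
  y-x+x≡y : ∀ y x → (y - x) + x ≡ y
  y-x+x≡y = solve 2 (λ y x → (y :- x) :+ x := y) refl

p≤q⇒0≤q-p : ∀ {x y} → x ≤ y → 0ℚ ≤ y - x
p≤q⇒0≤q-p {x} {y} x≤y = ≤-trans (≤-reflexive (sym (ℚ.+-inverseʳ x))) (ℚ.+-monoˡ-≤ (- x) x≤y)

≤-by-gap : ∀ {x y} g → 0ℚ ≤ g → g ≡ y - x → x ≤ y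
≤-by-gap g 0≤g refl = 0≤q-p⇒p≤q 0≤g

+-nonNeg : ∀ {x y} → 0ℚ ≤ x → 0ℚ ≤ y → 0ℚ ≤ x + y
+-nonNeg 0≤x 0≤y = +-mono-≤ 0≤x 0≤y

*-nonNeg : ∀ {x y} → 0ℚ ≤ x → 0ℚ ≤ y → 0ℚ ≤ x * y
*-nonNeg {x} 0≤x 0≤y =
  ≤-trans (≤-reflexive (sym (ℚ.*-zeroʳ x))) (ℚ.*-monoˡ-≤-nonNeg x {{nonNegative 0≤x}} 0≤y)

*-cancelʳ-≤-pos : ∀ {x y z} → 0ℚ < z → x * z ≤ y * z → x ≤ y
*-cancelʳ-≤-pos {z = z} 0<z = ℚ.*-cancelʳ-≤-pos z {{positive 0<z}}

*-monoʳ-≤-nonNeg : ∀ {x y z} → 0ℚ ≤ z → x ≤ y → x * z ≤ y * z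
*-monoʳ-≤-nonNeg {z = z} 0≤z = ℚ.*-monoʳ-≤-nonNeg z {{nonNegative 0≤z}}

*-monoˡ-≤-nonNeg : ∀ {x y z} → 0ℚ ≤ z → x ≤ y → z * x ≤ z * y
*-monoˡ-≤-nonNeg {z = z} 0≤z = ℚ.*-monoˡ-≤-nonNeg z {{nonNegative 0≤z}}

0≤1 : 0ℚ ≤ 1ℚ
0≤1 = ℚ.nonNegative⁻¹ 1ℚ

≤-ratio : ∀ {x y r s t} → 0ℚ < s → r * s ≡ t → s * x ≤ t * y → x ≤ r * y
≤-ratio {x} {y} {r} {s} {t} 0<s refl sx≤rsy = *-cancelʳ-≤-pos 0<s (begin
  x * s        ≡⟨ *-comm x s ⟩
  s * x        ≤⟨ sx≤rsy ⟩
  r * s * y    ≡⟨ rsy≡rys r s y ⟩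
  r * y * s    ∎)
  where
  open ≤-Reasoning
  rsy≡rys : ∀ r s y → r * s * y ≡ r * y * s
  rsy≡rys = solve 3 (λ r s y → r :* s :* y := r :* y :* s) refl

fraction-bound : ∀ {x y r s} → 0ℚ < 1ℚ - s → r * (1ℚ - s) ≡ s → x ≤ s * (x + y) → x ≤ r * y
fraction-bound {x} {y} {r} {s} 0<1-s r[1-s]≡s x≤s[x+y] =
  ≤-ratio {r = r} 0<1-s r[1-s]≡s (≤-by-gap _ (p≤q⇒0≤q-p x≤s[x+y]) (gap x y s))
  where
  gap : ∀ x y s → s * (x + y) - x ≡ s * y - (1ℚ - s) * x
  gap = solve 3 (λ x y s → s :* (x :+ y) :- x := s :* y :- (con 1ℚ :- s) :* x) refl

min-avg-bound : ∀ {L₁ L₂ a x y SQ SI K} → 1ℚ ≤ K → 0ℚ ≤ a → 0ℚ ≤ y → 0ℚ < x →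
                L₁ ≤ a * x → L₂ * x ≤ y * SQ → a * x ≤ SQ → a * y ≤ SI → y ≤ K * x →
                L₂ + L₁ ≤ K * (SI + SQ)
min-avg-bound {L₁} {L₂} {a} {x} {y} {SQ} {SI} {K} 1≤K 0≤a 0≤y 0<x L₁≤ax L₂x≤ySQ ax≤SQ ay≤SI y≤Kx =
  *-cancelʳ-≤-pos 0<x (≤-by-gap _ 0≤gap (gap L₁ L₂ a x y SQ SI K))
  where
  0≤x = <⇒≤ 0<x
  0≤K = ≤-trans 0≤1 1≤K
  0≤gap : 0ℚ ≤ (SQ - a * x) * (K * x - y) + a * x * (K - 1ℚ) * (x + y)
               + x * K * (SI - a * y) + x * (a * x - L₁) + (y * SQ - L₂ * x)
  0≤gap = +-nonNeg (+-nonNeg (+-nonNeg (+-nonNeg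
    (*-nonNeg (p≤q⇒0≤q-p ax≤SQ) (p≤q⇒0≤q-p y≤Kx))
    (*-nonNeg (*-nonNeg (*-nonNeg 0≤a 0≤x) (p≤q⇒0≤q-p 1≤K)) (+-nonNeg 0≤x 0≤y)))
    (*-nonNeg (*-nonNeg 0≤x 0≤K) (p≤q⇒0≤q-p ay≤SI)))
    (*-nonNeg 0≤x (p≤q⇒0≤q-p L₁≤ax)))
    (p≤q⇒0≤q-p L₂x≤ySQ)
  gap : ∀ L₁ L₂ a x y SQ SI K →
        (SQ - a * x) * (K * x - y) + a * x * (K - 1ℚ) * (x + y)
          + x * K * (SI - a * y) + x * (a * x - L₁) + (y * SQ - L₂ * x)
        ≡ K * (SI + SQ) * x - (L₂ + L₁) * x
  gap = solve 8 (λ L₁ L₂ a x y SQ SI K →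
          (SQ :- a :* x) :* (K :* x :- y) :+ a :* x :* (K :- con 1ℚ) :* (x :+ y)
            :+ x :* K :* (SI :- a :* y) :+ x :* (a :* x :- L₁) :+ (y :* SQ :- L₂ :* x)
          := K :* (SI :+ SQ) :* x :- (L₂ :+ L₁) :* x) refl

*-cancelʳ-≡-pos : ∀ {x y z} → 0ℚ < z → x * z ≡ y * z → x ≡ y
*-cancelʳ-≡-pos 0<z xz≡yz =
  ℚ.≤-antisym (*-cancelʳ-≤-pos 0<z (≤-reflexive xz≡yz)) (*-cancelʳ-≤-pos 0<z (≤-reflexive (sym xz≡yz)))

/ℚ-*-cancel : ∀ x y → y ≢ 0ℚ → (x /ℚ y) * y ≡ x
/ℚ-*-cancel x y y≢0 with y ℚ.≟ 0ℚ
... | yes y≡0 = ⊥-elim (y≢0 y≡0)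
... | no  y≢0′ = trans (ℚ.*-assoc x _ y)
                   (trans (cong (x *_) (ℚ.*-inverseˡ y {{ℚ.≢-nonZero y≢0′}})) (ℚ.*-identityʳ x))

-- Finite sums

open SemiringSum (CommutativeRing.semiring ℚ.+-*-commutativeRing)
  using (sum; sum-cong-≗; sum-replicate-zero; ∑-distrib-+; ∑-comm; *-distribˡ-sum; *-distribʳ-sum)

sumFin≡sum : (f : Fin n → ℚ) → sumFin f ≡ sum f
sumFin≡sum {ℕ.zero}  f = refl
sumFin≡sum {ℕ.suc n} f = cong (f zero +_) (sumFin≡sum (f ∘ suc))

sumFin-cong : {f g : Fin n → ℚ} → (∀ i → f i ≡ g i) → sumFin f ≡ sumFin g
sumFin-cong {f = f} {g} f≗g = begin
  sumFin f ≡⟨ sumFin≡sum f ⟩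
  sum f    ≡⟨ sum-cong-≗ f≗g ⟩
  sum g    ≡⟨ sumFin≡sum g ⟨
  sumFin g ∎
  where open ≡-Reasoning

sumFin-zero : ∀ n → sumFin {n} (λ _ → 0ℚ) ≡ 0ℚ
sumFin-zero n = trans (sumFin≡sum {n} (λ _ → 0ℚ)) (sum-replicate-zero n)

sumFin-+ : (f g : Fin n → ℚ) → sumFin (λ i → f i + g i) ≡ sumFin f + sumFin g
sumFin-+ f g = begin
  sumFin (λ i → f i + g i) ≡⟨ sumFin≡sum (λ i → f i + g i) ⟩
  sum (λ i → f i + g i)    ≡⟨ ∑-distrib-+ f g ⟩
  sum f + sum g            ≡⟨ cong₂ _+_ (sumFin≡sum f) (sumFin≡sum g) ⟨
  sumFin f + sumFin g      ∎
  where open ≡-Reasoning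

sumFin-- : (f g : Fin n → ℚ) → sumFin (λ i → f i - g i) ≡ sumFin f - sumFin g
sumFin-- {ℕ.zero}  f g = refl
sumFin-- {ℕ.suc n} f g =
  trans (cong ((f zero - g zero) +_) (sumFin-- (f ∘ suc) (g ∘ suc)))
        (interchange (f zero) (g zero) (sumFin (f ∘ suc)) (sumFin (g ∘ suc)))
  where
  interchange : ∀ a b c d → (a - b) + (c - d) ≡ (a + c) - (b + d)
  interchange = solve 4 (λ a b c d → (a :- b) :+ (c :- d) := (a :+ c) :- (b :+ d)) refl

sumFin-*ˡ : ∀ c (f : Fin n → ℚ) → sumFin (λ i → c * f i) ≡ c * sumFin f
sumFin-*ˡ c f = begin
  sumFin (λ i → c * f i) ≡⟨ sumFin≡sum (λ i → c * f i) ⟩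
  sum (λ i → c * f i)    ≡⟨ *-distribˡ-sum c f ⟨
  c * sum f              ≡⟨ cong (c *_) (sumFin≡sum f) ⟨
  c * sumFin f           ∎
  where open ≡-Reasoning

sumFin-comm : ∀ {k} (f : Fin n → Fin k → ℚ) →
              sumFin (λ i → sumFin (f i)) ≡ sumFin (λ j → sumFin (λ i → f i j))
sumFin-comm f = begin
  sumFin (λ i → sumFin (f i))        ≡⟨ sumFin-cong (λ i → sumFin≡sum (f i)) ⟩
  sumFin (λ i → sum (f i))           ≡⟨ sumFin≡sum (λ i → sum (f i)) ⟩
  sum (λ i → sum (f i))              ≡⟨ ∑-comm f ⟩
  sum (λ j → sum (λ i → f i j))      ≡⟨ sumFin≡sum (λ j → sum (λ i → f i j)) ⟨
  sumFin (λ j → sum (λ i → f i j))   ≡⟨ sumFin-cong (λ j → sumFin≡sum (λ i → f i j)) ⟨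
  sumFin (λ j → sumFin (λ i → f i j)) ∎
  where open ≡-Reasoning

sumFin-*-sumFin : ∀ {k} (f : Fin n → ℚ) (g : Fin k → ℚ) →
                  sumFin f * sumFin g ≡ sumFin (λ i → sumFin (λ j → f i * g j))
sumFin-*-sumFin f g = begin
  sumFin f * sumFin g                    ≡⟨ cong (_* sumFin g) (sumFin≡sum f) ⟩
  sum f * sumFin g                       ≡⟨ *-distribʳ-sum (sumFin g) f ⟩
  sum (λ i → f i * sumFin g)             ≡⟨ sumFin≡sum (λ i → f i * sumFin g) ⟨
  sumFin (λ i → f i * sumFin g)          ≡⟨ sumFin-cong (λ i → sumFin-*ˡ (f i) g) ⟨
  sumFin (λ i → sumFin (λ j → f i * g j)) ∎
  where open ≡-Reasoning

sumFin-mono-≤ : {f g : Fin n → ℚ} → (∀ i → f i ≤ g i) → sumFin f ≤ sumFin g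
sumFin-mono-≤ {ℕ.zero}  f≤g = ≤-refl
sumFin-mono-≤ {ℕ.suc n} f≤g = +-mono-≤ (f≤g zero) (sumFin-mono-≤ (f≤g ∘ suc))

sumFin-nonNeg : {f : Fin n → ℚ} → (∀ i → 0ℚ ≤ f i) → 0ℚ ≤ sumFin f
sumFin-nonNeg {n} 0≤f = ≤-trans (≤-reflexive (sym (sumFin-zero n))) (sumFin-mono-≤ 0≤f)

index-of-positive-sum : {f : Fin n → ℚ} → 0ℚ < sumFin f → Fin n
index-of-positive-sum {ℕ.zero}  0<0 = ⊥-elim (ℚ.<-irrefl refl 0<0)
index-of-positive-sum {ℕ.suc n} _   = zero

term≤sumFin : {f : Fin n → ℚ} → (∀ i → 0ℚ ≤ f i) → ∀ i → f i ≤ sumFin f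
term≤sumFin {f = f} 0≤f zero = begin
  f zero               ≡⟨ ℚ.+-identityʳ (f zero) ⟨
  f zero + 0ℚ          ≤⟨ ℚ.+-monoʳ-≤ (f zero) (sumFin-nonNeg (0≤f ∘ suc)) ⟩
  sumFin f             ∎
  where open ≤-Reasoning
term≤sumFin {f = f} 0≤f (suc i) = begin
  f (suc i)                  ≤⟨ term≤sumFin (0≤f ∘ suc) i ⟩
  sumFin (f ∘ suc)           ≡⟨ ℚ.+-identityˡ _ ⟨
  0ℚ + sumFin (f ∘ suc)      ≤⟨ ℚ.+-monoˡ-≤ _ (0≤f zero) ⟩
  sumFin f                   ∎
  where open ≤-Reasoning

sumFin-point : ∀ j (f : Fin n → ℚ) → sumFin (λ i → if j == i then f i else 0ℚ) ≡ f j
sumFin-point {ℕ.suc n} zero    f = trans (cong (f zero +_) (sumFin-zero n)) (ℚ.+-identityʳ (f zero))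
sumFin-point {ℕ.suc n} (suc j) f = trans (ℚ.+-identityˡ _) (sumFin-point j (f ∘ suc))

sumFin-fibres : ∀ {k} (σ : Fin n → Fin k) (f : Fin n → ℚ) →
                sumFin f ≡ sumFin (λ o → sumFin (λ j → if σ j == o then f j else 0ℚ))
sumFin-fibres σ f = begin
  sumFin f                                                ≡⟨ sumFin-cong (λ j → sumFin-point (σ j) (λ _ → f j)) ⟨
  sumFin (λ j → sumFin (λ o → if σ j == o then f j else 0ℚ)) ≡⟨ sumFin-comm (λ j o → if σ j == o then f j else 0ℚ) ⟩
  sumFin (λ o → sumFin (λ j → if σ j == o then f j else 0ℚ)) ∎
  where open ≡-Reasoning

∧-elimˡ : ∀ a {b} → T (a ∧ b) → T a
∧-elimˡ true _ = _

∧-elimʳ : ∀ a {b} → T (a ∧ b) → T b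
∧-elimʳ true tb = tb

∧-intro : ∀ a {b} → T a → T b → T (a ∧ b)
∧-intro true _ tb = tb

T-not⁻ : ∀ {a} → T (not a) → ¬ T a
T-not⁻ {false} _ ()

T-not⁺ : ∀ {a} → ¬ T a → T (not a)
T-not⁺ {true}  ¬a = ¬a _
T-not⁺ {false} _  = _

does⇒ : ∀ {ℓ} {A : Set ℓ} (a? : Dec A) → T (does a?) → A
does⇒ (yes a) _ = a

⇒does : ∀ {ℓ} {A : Set ℓ} (a? : Dec A) → A → T (does a?)
⇒does (yes _) _ = _
⇒does (no ¬a) a = ¬a a

<ᵇ⇒< : ∀ {x y} → T (x <ᵇ y) → x < y
<ᵇ⇒< {x} {y} = does⇒ (x ℚ.<? y)

¬<ᵇ⇒≥ : ∀ {x y} → ¬ T (x <ᵇ y) → y ≤ x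
¬<ᵇ⇒≥ {x} {y} x≮ᵇy = ≮⇒≥ (x≮ᵇy ∘ ⇒does (x ℚ.<? y))

==⇒≡ : {i j : Fin n} → T (i == j) → i ≡ j
==⇒≡ {i = i} {j} = does⇒ (i Fin.≟ j)

≡⇒== : {i j : Fin n} → i ≡ j → T (i == j)
≡⇒== {i = i} {j} = ⇒does (i Fin.≟ j)

anyFin⇒∃ : {P : Fin n → Bool} → T (anyFin P) → ∃[ i ] T (P i)
anyFin⇒∃ {ℕ.suc n} {P} any with Equivalence.to T-∨ any
... | inj₁ P0   = zero , P0
... | inj₂ rest = let (i , Pi) = anyFin⇒∃ rest in suc i , Pi

-- Sums over a Boolean predicate

sumWhere : (Fin n → Bool) → (Fin n → ℚ) → ℚ
sumWhere P f = sumFin (λ i → if P i then f i else 0ℚ)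

size : (Fin n → Bool) → ℚ
size P = sumWhere P (λ _ → 1ℚ)

if-mono-≤ : ∀ b c {x y} → (T b → T c) → (T c → 0ℚ ≤ y) → (T b → x ≤ y) →
            (if b then x else 0ℚ) ≤ (if c then y else 0ℚ)
if-mono-≤ false false _   _   _   = ≤-refl
if-mono-≤ false true  _   0≤y _   = 0≤y _
if-mono-≤ true  true  _   _   x≤y = x≤y _
if-mono-≤ true  false b⇒c _   _   = ⊥-elim (b⇒c _)

if-monoʳ-≤ : ∀ b {x y} → (T b → x ≤ y) → (if b then x else 0ℚ) ≤ (if b then y else 0ℚ)
if-monoʳ-≤ false _   = ≤-refl
if-monoʳ-≤ true  x≤y = x≤y _

sumWhere-⊆ : (P Q : Fin n → Bool) {f g : Fin n → ℚ} →
             (∀ i → T (P i) → T (Q i)) → (∀ i → T (Q i) → 0ℚ ≤ g i) →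
             (∀ i → T (P i) → f i ≤ g i) → sumWhere P f ≤ sumWhere Q g
sumWhere-⊆ P Q P⊆Q 0≤g f≤g =
  sumFin-mono-≤ (λ i → if-mono-≤ (P i) (Q i) (P⊆Q i) (0≤g i) (f≤g i))

sumWhere-mono-≤ : (P : Fin n → Bool) {f g : Fin n → ℚ} →
                  (∀ i → T (P i) → f i ≤ g i) → sumWhere P f ≤ sumWhere P g
sumWhere-mono-≤ P f≤g = sumFin-mono-≤ (λ i → if-monoʳ-≤ (P i) (f≤g i))

if-nonNeg : ∀ b {x} → (T b → 0ℚ ≤ x) → 0ℚ ≤ (if b then x else 0ℚ)
if-nonNeg false _   = ≤-refl
if-nonNeg true  0≤x = 0≤x _

if-true : ∀ b {x} → T b → (if b then x else 0ℚ) ≡ x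
if-true true _ = refl

if-false : ∀ b {x} → ¬ T b → (if b then x else 0ℚ) ≡ 0ℚ
if-false false _  = refl
if-false true  ¬b = ⊥-elim (¬b _)

sumWhere-nonNeg : (P : Fin n → Bool) {f : Fin n → ℚ} → (∀ i → T (P i) → 0ℚ ≤ f i) → 0ℚ ≤ sumWhere P f
sumWhere-nonNeg P 0≤f = sumFin-nonNeg (λ i → if-nonNeg (P i) (0≤f i))

sumWhere-empty : (P : Fin n → Bool) {f : Fin n → ℚ} → (∀ i → ¬ T (P i)) → sumWhere P f ≡ 0ℚ
sumWhere-empty {n} P ¬P = trans (sumFin-cong (λ i → if-false (P i) (¬P i))) (sumFin-zero n)

sumWhere-+ : (P : Fin n → Bool) (f g : Fin n → ℚ) →
             sumWhere P (λ i → f i + g i) ≡ sumWhere P f + sumWhere P g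
sumWhere-+ P f g = trans (sumFin-cong (λ i → if-+ (P i)))
                          (sumFin-+ (λ i → if P i then f i else 0ℚ) (λ i → if P i then g i else 0ℚ))
  where
  if-+ : ∀ b {x y} → (if b then x + y else 0ℚ) ≡ (if b then x else 0ℚ) + (if b then y else 0ℚ)
  if-+ true  = refl
  if-+ false = refl

sumWhere-*ˡ : (P : Fin n → Bool) (c : ℚ) (f : Fin n → ℚ) →
              sumWhere P (λ i → c * f i) ≡ c * sumWhere P f
sumWhere-*ˡ P c f = trans (sumFin-cong (λ i → if-*ˡ (P i))) (sumFin-*ˡ c (λ i → if P i then f i else 0ℚ))
  where
  if-*ˡ : ∀ b {x} → (if b then c * x else 0ℚ) ≡ c * (if b then x else 0ℚ)
  if-*ˡ true  = refl
  if-*ˡ false = sym (ℚ.*-zeroʳ c)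

sumWhere-split : (P Q : Fin n → Bool) (f : Fin n → ℚ) →
                 sumWhere P f ≡ sumWhere (λ i → P i ∧ Q i) f + sumWhere (λ i → P i ∧ not (Q i)) f
sumWhere-split P Q f = trans (sumFin-cong (λ i → if-split (P i) (Q i)))
  (sumFin-+ (λ i → if P i ∧ Q i then f i else 0ℚ) (λ i → if P i ∧ not (Q i) then f i else 0ℚ))
  where
  if-split : ∀ b c {x} → (if b then x else 0ℚ) ≡ (if b ∧ c then x else 0ℚ) + (if b ∧ not c then x else 0ℚ)
  if-split false _         = refl
  if-split true  true  {x} = sym (ℚ.+-identityʳ x)
  if-split true  false {x} = sym (ℚ.+-identityˡ x)

sumWhere-const : (P : Fin n → Bool) (c : ℚ) → sumWhere P (λ _ → c) ≡ c * size P
sumWhere-const P c = trans (sumFin-cong (λ i → cong (λ z → if P i then z else 0ℚ) (sym (ℚ.*-identityʳ c))))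
                           (sumWhere-*ˡ P c (λ _ → 1ℚ))

size-≤-sumWhere : (P : Fin n → Bool) {f : Fin n → ℚ} {c : ℚ} →
                  (∀ i → T (P i) → c ≤ f i) → c * size P ≤ sumWhere P f
size-≤-sumWhere P {c = c} c≤f = ≤-trans (≤-reflexive (sym (sumWhere-const P c))) (sumWhere-mono-≤ P c≤f)

size-nonNeg : (P : Fin n → Bool) → 0ℚ ≤ size P
size-nonNeg P = sumWhere-nonNeg P (λ _ _ → 0≤1)

1≤size : (P : Fin n → Bool) → ∀ i → T (P i) → 1ℚ ≤ size P
1≤size P i Pi = ≤-trans (≤-reflexive (sym (if-true (P i) Pi)))
                              (term≤sumFin (λ j → if-nonNeg (P j) (λ _ → 0≤1)) i)

size≤0⇒empty : (P : Fin n → Bool) → size P ≤ 0ℚ → ∀ i → ¬ T (P i)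
size≤0⇒empty P size≤0 i Pi =
  ℚ.<-irrefl refl (ℚ.<-≤-trans (ℚ.positive⁻¹ 1ℚ) (≤-trans (1≤size P i Pi) size≤0))

sumWhere-cross : (P Q : Fin n → Bool) {f g : Fin n → ℚ} →
                 (∀ i j → T (P i) → T (Q j) → f i ≤ g j) →
                 sumWhere P f * size Q ≤ size P * sumWhere Q g
sumWhere-cross P Q {f} {g} f≤g = begin
  sumWhere P f * size Q
    ≡⟨ sumFin-*-sumFin (λ i → if P i then f i else 0ℚ) (λ j → if Q j then 1ℚ else 0ℚ) ⟩
  sumFin (λ i → sumFin (λ j → (if P i then f i else 0ℚ) * (if Q j then 1ℚ else 0ℚ)))
    ≤⟨ sumFin-mono-≤ (λ i → sumFin-mono-≤ (λ j → if-cross (P i) (Q j) (f≤g i j))) ⟩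
  sumFin (λ i → sumFin (λ j → (if P i then 1ℚ else 0ℚ) * (if Q j then g j else 0ℚ)))
    ≡⟨ sumFin-*-sumFin (λ i → if P i then 1ℚ else 0ℚ) (λ j → if Q j then g j else 0ℚ) ⟨
  size P * sumWhere Q g ∎
  where
  open ≤-Reasoning
  if-cross : ∀ b c {x y} → (T b → T c → x ≤ y) →
             (if b then x else 0ℚ) * (if c then 1ℚ else 0ℚ) ≤ (if b then 1ℚ else 0ℚ) * (if c then y else 0ℚ)
  if-cross true  true  {x} {y} x≤y = begin
    x * 1ℚ  ≡⟨ ℚ.*-identityʳ x ⟩
    x       ≤⟨ x≤y _ _ ⟩
    y       ≡⟨ ℚ.*-identityˡ y ⟨
    1ℚ * y  ∎
  if-cross true  false {x} _ = ≤-reflexive (ℚ.*-zeroʳ x)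
  if-cross false c {y = y} _ =
    ≤-reflexive (trans (ℚ.*-zeroˡ (if c then 1ℚ else 0ℚ)) (sym (ℚ.*-zeroˡ (if c then y else 0ℚ))))

sumWhere-average : (P Q : Fin n → Bool) {f g : Fin n → ℚ} {c : ℚ} →
                   (∀ i j → T (P i) → T (Q j) → f i ≤ g j) → (∀ j → T (Q j) → 0ℚ ≤ g j) →
                   size P ≤ c * size Q → sumWhere P f ≤ c * sumWhere Q g
sumWhere-average P Q {f} {g} {c} f≤g 0≤g |P|≤c|Q| with size Q ℚ.≤? 0ℚ
... | yes |Q|≤0 = begin
  sumWhere P f       ≡⟨ sumWhere-empty P (size≤0⇒empty P |P|≤0) ⟩
  0ℚ                 ≡⟨ ℚ.*-zeroʳ c ⟨
  c * 0ℚ             ≡⟨ cong (c *_) (sumWhere-empty Q Q-empty) ⟨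
  c * sumWhere Q g   ∎
  where
  open ≤-Reasoning
  Q-empty = size≤0⇒empty Q |Q|≤0
  |P|≤0 : size P ≤ 0ℚ
  |P|≤0 = ≤-trans |P|≤c|Q| (≤-reflexive (trans (cong (c *_) (sumWhere-empty Q Q-empty)) (ℚ.*-zeroʳ c)))
... | no |Q|≰0 = *-cancelʳ-≤-pos (≰⇒> |Q|≰0) (begin
  sumWhere P f * size Q         ≤⟨ sumWhere-cross P Q f≤g ⟩
  size P * sumWhere Q g         ≤⟨ *-monoʳ-≤-nonNeg (sumWhere-nonNeg Q 0≤g) |P|≤c|Q| ⟩
  c * size Q * sumWhere Q g     ≡⟨ swap23 c (size Q) (sumWhere Q g) ⟩
  c * sumWhere Q g * size Q     ∎)
  where
  open ≤-Reasoning
  swap23 : ∀ a b d → a * b * d ≡ a * d * b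
  swap23 = solve 3 (λ a b d → a :* b :* d := a :* d :* b) refl

sumWhere-fibres : ∀ {k} (σ : Fin n → Fin k) (P : Fin n → Bool) (f : Fin n → ℚ) →
                  sumWhere P f ≡ sumFin (λ o → sumWhere (λ j → (σ j == o) ∧ P j) f)
sumWhere-fibres σ P f =
  trans (sumFin-fibres σ (λ j → if P j then f j else 0ℚ))
        (sumFin-cong (λ o → sumFin-cong (λ j → if-∧ (σ j == o))))
  where
  if-∧ : ∀ b {c x} → (if b then (if c then x else 0ℚ) else 0ℚ) ≡ (if b ∧ c then x else 0ℚ)
  if-∧ true  = refl
  if-∧ false = refl

sumWhere-fibrewise-≤ : ∀ {k} (σ : Fin n → Fin k) (P Q : Fin n → Bool) {f g : Fin n → ℚ} →
                       (∀ o → sumWhere (λ j → (σ j == o) ∧ P j) f ≤ sumWhere (λ j → (σ j == o) ∧ Q j) g) →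
                       sumWhere P f ≤ sumWhere Q g
sumWhere-fibrewise-≤ σ P Q {f} {g} fibre≤ = begin
  sumWhere P f                                          ≡⟨ sumWhere-fibres σ P f ⟩
  sumFin (λ o → sumWhere (λ j → (σ j == o) ∧ P j) f)    ≤⟨ sumFin-mono-≤ fibre≤ ⟩
  sumFin (λ o → sumWhere (λ j → (σ j == o) ∧ Q j) g)    ≡⟨ sumWhere-fibres σ Q g ⟨
  sumWhere Q g                                          ∎
  where open ≤-Reasoning

sumWhere-∘ : ∀ {k} (σ : Fin n → Fin k) (P : Fin k → Bool) (f : Fin n → ℚ) →
             sumWhere (P ∘ σ) f ≡ sumWhere P (λ o → sumWhere (λ j → σ j == o) f)
sumWhere-∘ {n} σ P f = begin
  sumWhere (P ∘ σ) f
    ≡⟨ sumFin-fibres σ (λ j → if P (σ j) then f j else 0ℚ) ⟩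
  sumFin (λ o → sumFin (λ j → if σ j == o then (if P (σ j) then f j else 0ℚ) else 0ℚ))
    ≡⟨ sumFin-cong (λ o → sumFin-cong (λ j → if-fibre (σ j) o)) ⟩
  sumFin (λ o → sumFin (λ j → if P o then (if σ j == o then f j else 0ℚ) else 0ℚ))
    ≡⟨ sumFin-cong (λ o → if-sumFin (P o)) ⟨
  sumWhere P (λ o → sumWhere (λ j → σ j == o) f) ∎
  where
  open ≡-Reasoning
  if-fibre : ∀ a o {x} → (if a == o then (if P a then x else 0ℚ) else 0ℚ)
                        ≡ (if P o then (if a == o then x else 0ℚ) else 0ℚ)
  if-fibre a o with a Fin.≟ o
  ... | yes refl = refl
  ... | no _ with P o
  ...   | true  = refl
  ...   | false = refl
  if-sumFin : ∀ b {g : Fin n → ℚ} → (if b then sumFin g else 0ℚ) ≡ sumFin (λ j → if b then g j else 0ℚ)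
  if-sumFin true  = refl
  if-sumFin false = sym (sumFin-zero n)

sumWhere-cong-on : (R P Q : Fin n → Bool) (f : Fin n → ℚ) → (∀ i → T (R i) → P i ≡ Q i) →
                   sumWhere (λ i → R i ∧ P i) f ≡ sumWhere (λ i → R i ∧ Q i) f
sumWhere-cong-on R P Q f P≡Q = sumFin-cong (λ i → if-∧-cong (R i) (P≡Q i))
  where
  if-∧-cong : ∀ r {p q x} → (T r → p ≡ q) → (if r ∧ p then x else 0ℚ) ≡ (if r ∧ q then x else 0ℚ)
  if-∧-cong true  p≡q = cong (λ b → if b then _ else 0ℚ) (p≡q _)
  if-∧-cong false _   = refl

sumWhere-cong : (P : Fin n → Bool) {f g : Fin n → ℚ} → (∀ i → f i ≡ g i) → sumWhere P f ≡ sumWhere P g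
sumWhere-cong P f≗g = sumFin-cong (λ i → cong (λ z → if P i then z else 0ℚ) (f≗g i))

sumWhere-cong-pred : {P Q : Fin n → Bool} (f : Fin n → ℚ) → (∀ i → P i ≡ Q i) → sumWhere P f ≡ sumWhere Q f
sumWhere-cong-pred f P≗Q = sumFin-cong (λ i → cong (λ b → if b then f i else 0ℚ) (P≗Q i))

sumWhere-∧-redundant : (P Q : Fin n → Bool) (f : Fin n → ℚ) → (∀ i → T (P i) → T (Q i)) →
                       sumWhere (λ i → P i ∧ Q i) f ≡ sumWhere P f
sumWhere-∧-redundant P Q f P⇒Q = sumFin-cong (λ i → if-∧-redundant (P i) (P⇒Q i))
  where
  if-∧-redundant : ∀ b {c x} → (T b → T c) → (if b ∧ c then x else 0ℚ) ≡ (if b then x else 0ℚ)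
  if-∧-redundant false _ = refl
  if-∧-redundant true  {true}  _   = refl
  if-∧-redundant true  {false} b⇒c = ⊥-elim (b⇒c _)

sumWhere-on-fibre : ∀ {k} (σ : Fin n → Fin k) (o : Fin k) (P : Fin k → Fin n → Bool) (f : Fin n → ℚ) →
                    sumWhere (λ j → (σ j == o) ∧ P (σ j) j) f ≡ sumWhere (λ j → (σ j == o) ∧ P o j) f
sumWhere-on-fibre σ o P f =
  sumWhere-cong-on (λ j → σ j == o) (λ j → P (σ j) j) (λ j → P o j) f (λ j σj==o → cong (λ a → P a j) (==⇒≡ σj==o))

toℚ≡mkℚ : ∀ a → toℚ a ≡ mkℚ (ℤ.+ a) 0 (Coprime.sym (Coprime.1-coprimeTo a))
toℚ≡mkℚ a = ℚ.normalize-coprime (Coprime.sym (Coprime.1-coprimeTo a))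

toℚ-homo-+ : ∀ a b → toℚ (a ℕ.+ b) ≡ toℚ a + toℚ b
toℚ-homo-+ a b = ℚ.toℚᵘ-injective (begin
  ℚ.toℚᵘ (toℚ (a ℕ.+ b))                     ≡⟨ cong ℚ.toℚᵘ (toℚ≡mkℚ (a ℕ.+ b)) ⟩
  ℚᵘ.mkℚᵘ (ℤ.+ (a ℕ.+ b)) 0                  ≈⟨ ℚᵘ.*≡* integers ⟩
  ℚᵘ.mkℚᵘ (ℤ.+ a) 0 ℚᵘ.+ ℚᵘ.mkℚᵘ (ℤ.+ b) 0   ≡⟨ cong₂ ℚᵘ._+_ (cong ℚ.toℚᵘ (toℚ≡mkℚ a)) (cong ℚ.toℚᵘ (toℚ≡mkℚ b)) ⟨
  ℚ.toℚᵘ (toℚ a) ℚᵘ.+ ℚ.toℚᵘ (toℚ b)         ≈⟨ ℚ.toℚᵘ-homo-+ (toℚ a) (toℚ b) ⟨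
  ℚ.toℚᵘ (toℚ a + toℚ b)                     ∎)
  where
  open ℚᵘ.≃-Reasoning
  integers : ℤ.+ (a ℕ.+ b) ℤ.* ℤ.+ 1 ≡ (ℤ.+ a ℤ.* ℤ.+ 1 ℤ.+ ℤ.+ b ℤ.* ℤ.+ 1) ℤ.* ℤ.+ 1
  integers = trans (ℤ.*-identityʳ _) (trans (ℤ.pos-+ a b) (sym (trans (ℤ.*-identityʳ _)
               (cong₂ ℤ._+_ (ℤ.*-identityʳ (ℤ.+ a)) (ℤ.*-identityʳ (ℤ.+ b))))))

toℚ-nonNeg : ∀ a → 0ℚ ≤ toℚ a
toℚ-nonNeg a = ℚ.nonNegative⁻¹ (toℚ a) {{ℚ.normalize-nonNeg a 1}}

toℚ-mono-≤ : ∀ {a b} → a ≤ℕ b → toℚ a ≤ toℚ b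
toℚ-mono-≤ {a} {b} a≤b = begin
  toℚ a                    ≡⟨ ℚ.+-identityʳ (toℚ a) ⟨
  toℚ a + 0ℚ               ≤⟨ ℚ.+-monoʳ-≤ (toℚ a) (toℚ-nonNeg (b ℕ.∸ a)) ⟩
  toℚ a + toℚ (b ℕ.∸ a)    ≡⟨ toℚ-homo-+ a (b ℕ.∸ a) ⟨
  toℚ (a ℕ.+ (b ℕ.∸ a))    ≡⟨ cong toℚ (ℕ.m+[n∸m]≡n a≤b) ⟩
  toℚ b                    ∎
  where open ≤-Reasoning

countFin-size : (P : Fin n → Bool) → toℚ (countFin P) ≡ size P
countFin-size {ℕ.zero}  P = refl
countFin-size {ℕ.suc n} P =
  trans (toℚ-homo-+ (if P zero then 1 else 0) (countFin (P ∘ suc)))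
        (cong₂ _+_ (indicator (P zero)) (countFin-size (P ∘ suc)))
  where
  indicator : ∀ b → toℚ (if b then 1 else 0) ≡ (if b then 1ℚ else 0ℚ)
  indicator true  = refl
  indicator false = refl

-- Minimisers over a decidable subset of Fin n

module _ {ℓ} {P : Pred (Fin n) ℓ} (P? : Decidable P) (f : Fin n → ℚ) where

  argminOn : Fin n → Fin n
  argminOn i₀ = argmin f i₀ (filter P? (allFin n))

  argminOn-satisfies : ∀ {i₀} → P i₀ → P (argminOn i₀)
  argminOn-satisfies Pi₀ = argmin-all f Pi₀ (all-filter P? (allFin n))

  argminOn-minimal : ∀ i₀ {i} → P i → f (argminOn i₀) ≤ f i
  argminOn-minimal i₀ {i} Pi = lookup (f[argmin]≤f[xs] i₀ (filter P? (allFin n))) (∈-filter⁺ P? (∈-allFin i) Pi)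

x∈p⇒⁅x⁆⊆p : ∀ {S : Subset n} {x} → x ∈ S → ⁅ x ⁆ ⊆ S
x∈p⇒⁅x⁆⊆p {x = x} x∈S y∈⁅x⁆ = subst (_∈ _) (sym (x∈⁅y⁆⇒x≡y x y∈⁅x⁆)) x∈S

x∈p⇒1≤∣p∣ : ∀ {S : Subset n} {x} → x ∈ S → 1 ≤ℕ ∣ S ∣
x∈p⇒1≤∣p∣ {x = x} x∈S = subst (_≤ℕ _) (∣⁅x⁆∣≡1 x) (p⊆q⇒∣p∣≤∣q∣ (x∈p⇒⁅x⁆⊆p x∈S))

2≤∣p∣⇒p-x-nonempty : ∀ (S : Subset n) x → 2 ≤ℕ ∣ S ∣ → Nonempty (S ─ ⁅ x ⁆)
2≤∣p∣⇒p-x-nonempty S x 2≤∣S∣ with nonempty? (S ─ ⁅ x ⁆)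
... | yes ne = ne
... | no ¬ne = ⊥-elim (ℕ.<-irrefl refl (ℕ.≤-trans 2≤∣S∣ (ℕ.≤-trans (p⊆q⇒∣p∣≤∣q∣ S⊆⁅x⁆) (ℕ.≤-reflexive (∣⁅x⁆∣≡1 x)))))
  where
  S⊆⁅x⁆ : S ⊆ ⁅ x ⁆
  S⊆⁅x⁆ {y} y∈S with y Fin.≟ x
  ... | yes refl = x∈⁅x⁆ x
  ... | no  y≢x  = ⊥-elim (¬ne (y , x∈p∧x≢y⇒x∈p-y y∈S y≢x))

-- Facility location

module _ {m p : ℕ} (dist : Point m p → Point m p → ℚ) where
  open Instance dist

  closest : Subset p → Fin p → Fin m → Fin p
  closest S f₀ j = argminOn (_∈? S) (cdist j) f₀

  closest-Closest : ∀ S {f₀} → f₀ ∈ S → Closest S (closest S f₀)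
  closest-Closest S f₀∈S j =
    argminOn-satisfies (_∈? S) (cdist j) f₀∈S , λ f f∈S → argminOn-minimal (_∈? S) (cdist j) _ f∈S

  module _ (metric : IsMetric dist) where
    open IsMetric metric

    cdist-nonNeg : ∀ j f → 0ℚ ≤ cdist j f
    cdist-nonNeg j f = dist-nonneg (inj₁ j) (inj₂ f)

    cdist-detour : ∀ j i f g → cdist j g ≤ cdist j f + (cdist i f + cdist i g)
    cdist-detour j i f g = begin
      cdist j g
        ≤⟨ dist-tri (inj₁ j) (inj₂ f) (inj₂ g) ⟩
      cdist j f + dist (inj₂ f) (inj₂ g)
        ≤⟨ ℚ.+-monoʳ-≤ (cdist j f) (dist-tri (inj₂ f) (inj₁ i) (inj₂ g)) ⟩
      cdist j f + (dist (inj₂ f) (inj₁ i) + cdist i g)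
        ≡⟨ cong (λ d → cdist j f + (d + cdist i g)) (dist-sym (inj₂ f) (inj₁ i)) ⟩
      cdist j f + (cdist i f + cdist i g)
        ∎
      where open ≤-Reasoning

module Closing {m p : ℕ} (dist : Point m p → Point m p → ℚ) (metric : IsMetric dist)
               (S2 : Subset p) (σ2 : Fin m → Fin p) (closest2 : Instance.Closest dist S2 σ2)
               (2≤∣S2∣ : 2 ≤ℕ ∣ S2 ∣) where
  open Instance dist

  σ∖ : Fin p → Fin m → Fin p
  σ∖ f = closest dist (S2 ─ ⁅ f ⁆) (proj₁ (2≤∣p∣⇒p-x-nonempty S2 f 2≤∣S2∣))

  σ∖-Closest : ∀ f → Closest (S2 ─ ⁅ f ⁆) (σ∖ f)
  σ∖-Closest f = closest-Closest dist (S2 ─ ⁅ f ⁆) (proj₂ (2≤∣p∣⇒p-x-nonempty S2 f 2≤∣S2∣))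

  σ∖-minimal : ∀ f j g → g ∈ S2 → g ≢ f → cdist j (σ∖ f j) ≤ cdist j g
  σ∖-minimal f j g g∈S2 g≢f = proj₂ (σ∖-Closest f j) g (x∈p∧x≢y⇒x∈p-y g∈S2 g≢f)

  σ∖-unaffected : ∀ f j → σ2 j ≢ f → cdist j (σ∖ f j) ≡ cdist j (σ2 j)
  σ∖-unaffected f j σ2j≢f = ℚ.≤-antisym
    (σ∖-minimal f j (σ2 j) (proj₁ (closest2 j)) σ2j≢f)
    (proj₂ (closest2 j) (σ∖ f j) (p─q⊆p S2 ⁅ f ⁆ (proj₁ (σ∖-Closest f j))))

  reassign : Fin m → ℚ
  reassign j = cdist j (σ∖ (σ2 j) j)

  extra : Fin m → ℚ
  extra j = reassign j - cdist j (σ2 j)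

  extra-nonNeg : ∀ j → 0ℚ ≤ extra j
  extra-nonNeg j = p≤q⇒0≤q-p (proj₂ (closest2 j) (σ∖ (σ2 j) j) (p─q⊆p S2 _ (proj₁ (σ∖-Closest (σ2 j) j))))

  reassign-minimal : ∀ j g → g ∈ S2 → g ≢ σ2 j → reassign j ≤ cdist j g
  reassign-minimal j = σ∖-minimal (σ2 j) j

  closing-cost : ∀ f → connCost (σ∖ f) - connCost σ2 ≡ sumWhere (λ j → σ2 j == f) extra
  closing-cost f = begin
    connCost (σ∖ f) - connCost σ2
      ≡⟨ sumFin-- (λ j → cdist j (σ∖ f j)) (λ j → cdist j (σ2 j)) ⟨
    sumFin (λ j → cdist j (σ∖ f j) - cdist j (σ2 j))
      ≡⟨ sumFin-cong change ⟩
    sumWhere (λ j → σ2 j == f) extra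
      ∎
    where
    open ≡-Reasoning
    change : ∀ j → cdist j (σ∖ f j) - cdist j (σ2 j) ≡ (if σ2 j == f then extra j else 0ℚ)
    change j with σ2 j Fin.≟ f
    ... | yes refl  = refl
    ... | no σ2j≢f = trans (cong (_- cdist j (σ2 j)) (σ∖-unaffected f j σ2j≢f)) (ℚ.+-inverseʳ (cdist j (σ2 j)))

  extra-pair : ∀ j i → σ2 j ≡ σ2 i → extra j ≤ extra i + (cdist i (σ2 i) + cdist i (σ2 i))
  extra-pair j i σ2j≡σ2i =
    ≤-by-gap _ (p≤q⇒0≤q-p reassign-j≤) (gap (reassign j) (cdist j (σ2 j)) (reassign i) (cdist i (σ2 i)))
    where
    f = σ2 j
    reassign-j≤ : reassign j ≤ cdist j f + (cdist i (σ2 i) + reassign i)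
    reassign-j≤ = begin
      cdist j (σ∖ f j)
        ≤⟨ proj₂ (σ∖-Closest f j) (σ∖ f i) (proj₁ (σ∖-Closest f i)) ⟩
      cdist j (σ∖ f i)
        ≤⟨ cdist-detour dist metric j i f (σ∖ f i) ⟩
      cdist j f + (cdist i f + cdist i (σ∖ f i))
        ≡⟨ cong (λ g → cdist j f + (cdist i g + cdist i (σ∖ g i))) σ2j≡σ2i ⟩
      cdist j f + (cdist i (σ2 i) + reassign i)
        ∎
      where open ≤-Reasoning
    gap : ∀ ej bj ei bi → (bj + (bi + ei)) - ej ≡ ((ei - bi) + (bi + bi)) - (ej - bj)
    gap = solve 4 (λ ej bj ei bi → (bj :+ (bi :+ ei)) :- ej := ((ei :- bi) :+ (bi :+ bi)) :- (ej :- bj)) refl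

  closing-gain : ∀ {Δ lam} → 0ℚ ≤ lam → 1 ≤ℕ Δ → LocalOpt Δ lam S2 σ2 →
                 ∀ f → f ∈ S2 → lam ≤ sumWhere (λ j → σ2 j == f) extra
  closing-gain {Δ} {lam} 0≤lam 1≤Δ localOpt f f∈S2 = begin
    lam                                  ≤⟨ ≤-by-gap _ (p≤q⇒0≤q-p (≤-trans smaller-cost no-gain)) (gap lam t d2 d∖) ⟩
    d∖ - d2                              ≡⟨ closing-cost f ⟩
    sumWhere (λ j → σ2 j == f) extra     ∎
    where
    open ≤-Reasoning
    t  = toℚ ∣ S2 ─ ⁅ f ⁆ ∣
    d2 = connCost σ2
    d∖ = connCost (σ∖ f)
    no-gain : lam * toℚ ∣ S2 ∣ + d2 ≤ lam * t + d∖
    no-gain = ≮⇒≥ (subst (λ T → Closest T (σ∖ f) → ¬ (uflCost lam T (σ∖ f) < uflCost lam S2 σ2))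
                         (∪-identityʳ (S2 ─ ⁅ f ⁆))
                         (localOpt ⁅ f ⁆ ⊥ (x∈p⇒⁅x⁆⊆p f∈S2) (subst (_≤ℕ Δ) (sym (∣⁅x⁆∣≡1 f)) 1≤Δ)
                                   (subst (_≤ℕ Δ) (sym (∣⊥∣≡0 p)) ℕ.z≤n) (σ∖ f))
                         (σ∖-Closest f))
    smaller-cost : lam * (1ℚ + t) + d2 ≤ lam * toℚ ∣ S2 ∣ + d2
    smaller-cost = ℚ.+-monoˡ-≤ d2 (*-monoˡ-≤-nonNeg 0≤lam
                     (≤-trans (≤-reflexive (sym (toℚ-homo-+ 1 ∣ S2 ─ ⁅ f ⁆ ∣))) (toℚ-mono-≤ (x∈p⇒∣p-x∣<∣p∣ f∈S2))))
    gap : ∀ l t d2 d∖ → (l * t + d∖) - (l * (1ℚ + t) + d2) ≡ (d∖ - d2) - l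
    gap = solve 4 (λ l t d2 d∖ → (l :* t :+ d∖) :- (l :* (con 1ℚ :+ t) :+ d2) := (d∖ :- d2) :- l) refl

-- Analysis of a local optimum

bound-identity : ∀ {D K ε opt oM d2 dM NA NB} → opt ≢ 0ℚ →
                 D ≡ toℚ 2 + toℚ 2 * K → opt ≡ oM + NA → d2 ≡ dM + NB →
                 (D * (1ℚ - oM /ℚ opt) + (toℚ 2 * K) * (d2 /ℚ opt - dM /ℚ opt)
                   + (toℚ 2 * ε) * (dM /ℚ opt + oM /ℚ opt)) * opt
                 ≡ (NA + (ε * (oM + dM) + K * (NA + NB))) + (NA + (ε * (oM + dM) + K * (NA + NB)))
bound-identity {D} {K} {ε} {opt} {oM} {d2} {dM} {NA} {NB} opt≢0 D≡ opt≡ d2≡ = begin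
  (D * (1ℚ - oM /ℚ opt) + 2K * (d2 /ℚ opt - dM /ℚ opt) + 2ε * (dM /ℚ opt + oM /ℚ opt)) * opt
    ≡⟨ distribute D 2K 2ε (oM /ℚ opt) (d2 /ℚ opt) (dM /ℚ opt) opt ⟩
  D * (opt - oM /ℚ opt * opt) + 2K * (d2 /ℚ opt * opt - dM /ℚ opt * opt) + 2ε * (dM /ℚ opt * opt + oM /ℚ opt * opt)
    ≡⟨ cong₂ (λ a b → D * (opt - a) + 2K * (b - dM /ℚ opt * opt) + 2ε * (dM /ℚ opt * opt + a))
             (/ℚ-*-cancel oM opt opt≢0) (/ℚ-*-cancel d2 opt opt≢0) ⟩
  D * (opt - oM) + 2K * (d2 - dM /ℚ opt * opt) + 2ε * (dM /ℚ opt * opt + oM)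
    ≡⟨ cong (λ c → D * (opt - oM) + 2K * (d2 - c) + 2ε * (c + oM)) (/ℚ-*-cancel dM opt opt≢0) ⟩
  D * (opt - oM) + 2K * (d2 - dM) + 2ε * (dM + oM)
    ≡⟨ cong₂ (λ a b → D * (a - oM) + 2K * (b - dM) + 2ε * (dM + oM)) opt≡ d2≡ ⟩
  D * ((oM + NA) - oM) + 2K * ((dM + NB) - dM) + 2ε * (dM + oM)
    ≡⟨ cong (λ a → a * ((oM + NA) - oM) + 2K * ((dM + NB) - dM) + 2ε * (dM + oM)) D≡ ⟩
  (toℚ 2 + 2K) * ((oM + NA) - oM) + 2K * ((dM + NB) - dM) + 2ε * (dM + oM)
    ≡⟨ collect K ε oM dM NA NB ⟩
  (NA + (ε * (oM + dM) + K * (NA + NB))) + (NA + (ε * (oM + dM) + K * (NA + NB))) ∎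
  where
  open ≡-Reasoning
  2K 2ε : ℚ
  2K = toℚ 2 * K
  2ε = toℚ 2 * ε
  distribute : ∀ D s t α β γ o → (D * (1ℚ - α) + s * (β - γ) + t * (γ + α)) * o
                                 ≡ D * (o - α * o) + s * (β * o - γ * o) + t * (γ * o + α * o)
  distribute = solve 7 (λ D s t α β γ o → (D :* (con 1ℚ :- α) :+ s :* (β :- γ) :+ t :* (γ :+ α)) :* o
                         := D :* (o :- α :* o) :+ s :* (β :* o :- γ :* o) :+ t :* (γ :* o :+ α :* o)) refl
  collect : ∀ K ε oM dM NA NB →
            (toℚ 2 + toℚ 2 * K) * ((oM + NA) - oM) + toℚ 2 * K * ((dM + NB) - dM) + toℚ 2 * ε * (dM + oM)
            ≡ (NA + (ε * (oM + dM) + K * (NA + NB))) + (NA + (ε * (oM + dM) + K * (NA + NB)))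
  collect = solve 6 (λ K ε oM dM NA NB →
              (con (toℚ 2) :+ con (toℚ 2) :* K) :* ((oM :+ NA) :- oM) :+ con (toℚ 2) :* K :* ((dM :+ NB) :- dM)
                :+ con (toℚ 2) :* ε :* (dM :+ oM)
              := (NA :+ (ε :* (oM :+ dM) :+ K :* (NA :+ NB))) :+ (NA :+ (ε :* (oM :+ dM) :+ K :* (NA :+ NB)))) refl

module Analysis
  {m p : ℕ} (dist : Point m p → Point m p → ℚ) (metric : IsMetric dist)
  (k : ℕ) (OPT : Subset p) (σO : Fin m → Fin p) (optimal : Instance.KMedianOpt dist k OPT σO)
  (lam δ : ℚ) (0≤lam : 0ℚ ≤ lam) (0<δ : 0ℚ < δ) (δ≤½ : δ ≤ ½)
  (Δ : ℕ) (1≤Δ : 1 ≤ℕ Δ)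
  (S2 : Subset p) (σ2 : Fin m → Fin p) (closest2 : Instance.Closest dist S2 σ2)
  (k<∣S2∣ : k <ℕ ∣ S2 ∣) (localOpt : Instance.LocalOpt dist Δ lam S2 σ2)
  (0<opt : 0ℚ < Instance.connCost dist σO)
  where

  open Instance dist
  open Matching δ OPT σO S2 σ2

  σO∈OPT : ∀ j → σO j ∈ OPT
  σO∈OPT j = proj₁ (proj₁ (proj₂ optimal) j)

  2≤∣S2∣ : 2 ≤ℕ ∣ S2 ∣
  2≤∣S2∣ = ℕ.≤-trans (ℕ.s≤s 1≤k) k<∣S2∣
    where
    1≤k : 1 ≤ℕ k
    1≤k = subst (1 ≤ℕ_) (proj₁ optimal) (x∈p⇒1≤∣p∣ (σO∈OPT (index-of-positive-sum 0<opt)))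

  open Closing dist metric S2 σ2 closest2 2≤∣S2∣ public

  costO cost2 pathCost detour : Fin m → ℚ
  costO j    = cdist j (σO j)
  cost2 j    = cdist j (σ2 j)
  pathCost j = costO j + cost2 j
  detour j   = reassign j - costO j

  costO-nonNeg : ∀ j → 0ℚ ≤ costO j
  costO-nonNeg j = cdist-nonNeg dist metric j (σO j)

  cost2-nonNeg : ∀ j → 0ℚ ≤ cost2 j
  cost2-nonNeg j = cdist-nonNeg dist metric j (σ2 j)

  pathCost-nonNeg : ∀ j → 0ℚ ≤ pathCost j
  pathCost-nonNeg j = +-nonNeg (costO-nonNeg j) (cost2-nonNeg j)

  detour-bound : ∀ j i → σO i ≡ σO j → σ2 i ≢ σ2 j → detour j ≤ pathCost i
  detour-bound j i σOi≡σOj σ2i≢σ2j =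
    ≤-by-gap _ (p≤q⇒0≤q-p reassign≤) (gap (reassign j) (costO j) (pathCost i))
    where
    reassign≤ : reassign j ≤ costO j + pathCost i
    reassign≤ = begin
      reassign j                             ≤⟨ reassign-minimal j (σ2 i) (proj₁ (closest2 i)) σ2i≢σ2j ⟩
      cdist j (σ2 i)                         ≤⟨ cdist-detour dist metric j i (σO j) (σ2 i) ⟩
      costO j + (cdist i (σO j) + cost2 i)   ≡⟨ cong (λ o → costO j + (cdist i o + cost2 i)) σOi≡σOj ⟨
      costO j + pathCost i                   ∎
      where open ≤-Reasoning
    gap : ∀ r c v → (c + v) - r ≡ v - (r - c)
    gap = solve 3 (λ r c v → (c :+ v) :- r := v :- (r :- c)) refl

  K ε : ℚ
  K = (1ℚ - δ) /ℚ δ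
  ε = δ /ℚ (1ℚ - δ)

  0<1-δ : 0ℚ < 1ℚ - δ
  0<1-δ = ℚ.<-≤-trans (ℚ.positive⁻¹ ½) (≤-by-gap _ (p≤q⇒0≤q-p δ≤½) (gap δ))
    where
    gap : ∀ δ → ½ - δ ≡ (1ℚ - δ) - ½
    gap = solve 1 (λ δ → con ½ :- δ := (con 1ℚ :- δ) :- con ½) refl

  Kδ≡1-δ : K * δ ≡ 1ℚ - δ
  Kδ≡1-δ = /ℚ-*-cancel (1ℚ - δ) δ (ℚ.<⇒≢ 0<δ ∘ sym)

  ε[1-δ]≡δ : ε * (1ℚ - δ) ≡ δ
  ε[1-δ]≡δ = /ℚ-*-cancel δ (1ℚ - δ) (ℚ.<⇒≢ 0<1-δ ∘ sym)

  1≤K : 1ℚ ≤ K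
  1≤K = ≤-trans (≤-ratio {r = K} 0<δ Kδ≡1-δ δ≤1-δ) (≤-reflexive (ℚ.*-identityʳ K))
    where
    δ≤1-δ : δ * 1ℚ ≤ (1ℚ - δ) * 1ℚ
    δ≤1-δ = ≤-by-gap _ (*-nonNeg (+-nonNeg 0≤1 0≤1) (p≤q⇒0≤q-p δ≤½)) (gap δ)
      where
      gap : ∀ δ → (1ℚ + 1ℚ) * (½ - δ) ≡ (1ℚ - δ) * 1ℚ - δ * 1ℚ
      gap = solve 1 (λ δ → (con 1ℚ :+ con 1ℚ) :* (con ½ :- δ) := (con 1ℚ :- δ) :* con 1ℚ :- δ :* con 1ℚ) refl

  0≤K : 0ℚ ≤ K
  0≤K = ≤-trans 0≤1 1≤K

  0≤ε : 0ℚ ≤ ε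
  0≤ε = *-cancelʳ-≤-pos 0<1-δ (begin
    0ℚ * (1ℚ - δ)   ≡⟨ ℚ.*-zeroˡ (1ℚ - δ) ⟩
    0ℚ              ≤⟨ <⇒≤ 0<δ ⟩
    δ               ≡⟨ ε[1-δ]≡δ ⟨
    ε * (1ℚ - δ)    ∎)
    where open ≤-Reasoning

  2/δ≡2+2K : toℚ 2 /ℚ δ ≡ toℚ 2 + toℚ 2 * K
  2/δ≡2+2K = *-cancelʳ-≡-pos 0<δ (begin
    toℚ 2 /ℚ δ * δ                        ≡⟨ /ℚ-*-cancel (toℚ 2) δ (ℚ.<⇒≢ 0<δ ∘ sym) ⟩
    toℚ 2                                 ≡⟨ collapse (toℚ 2) δ ⟨
    toℚ 2 * δ + toℚ 2 * (1ℚ - δ)          ≡⟨ cong (λ x → toℚ 2 * δ + toℚ 2 * x) Kδ≡1-δ ⟨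
    toℚ 2 * δ + toℚ 2 * (K * δ)           ≡⟨ expand (toℚ 2) K δ ⟨
    (toℚ 2 + toℚ 2 * K) * δ               ∎)
    where
    open ≡-Reasoning
    expand : ∀ t K δ → (t + t * K) * δ ≡ t * δ + t * (K * δ)
    expand = solve 3 (λ t K δ → (t :+ t :* K) :* δ := t :* δ :+ t :* (K :* δ)) refl
    collapse : ∀ t δ → t * δ + t * (1ℚ - δ) ≡ t
    collapse = solve 2 (λ t δ → t :* δ :+ t :* (con 1ℚ :- δ) := t) refl

  lonely⇒∈S2 : ∀ f → T (lonely2 f) → f ∈ S2
  lonely⇒∈S2 f lonely = does⇒ (f ∈? S2) (∧-elimˡ (does (f ∈? S2)) lonely)

  lonely⇒unmatched : ∀ f → T (lonely2 f) → ¬ T (matched2 f)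
  lonely⇒unmatched f lonely = T-not⁻ (∧-elimʳ (does (f ∈? S2)) lonely)

  lonely⇒not-half-captured : ∀ f → T (lonely2 f) → ¬ T (setCaptures ½ σO (inM f) σ2 f)
  lonely⇒not-half-captured f lonely captured =
    lonely⇒unmatched f lonely (∧-intro (does (f ∈? S2)) (⇒does (f ∈? S2) (lonely⇒∈S2 f lonely)) captured)

  matched⇒captured : ∀ o → T (matchedO o) → ∃[ g ] T (matched2 g) × T (captures (1ℚ - δ) σ2 g σO o)
  matched⇒captured o matched =
    g , ∧-elimˡ (matched2 g) g∈M , ∧-elimʳ (does (o ∈? OPT)) (∧-elimʳ (matched2 g) g∈M)
    where
    some-g : ∃[ g ] T (matched2 g ∧ inM g o)
    some-g = anyFin⇒∃ (∧-elimʳ (does (o ∈? OPT)) matched)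
    g = proj₁ some-g
    g∈M = proj₂ some-g

  not-inM⇒not-captured : ∀ f o → o ∈ OPT → ¬ T (inM f o) → ¬ T (captures (1ℚ - δ) σ2 f σO o)
  not-inM⇒not-captured f o o∈OPT ¬inM captured = ¬inM (∧-intro (does (o ∈? OPT)) (⇒does (o ∈? OPT) o∈OPT) captured)

  lonelyClient ownCaptured capturedLonely freeLonely : Fin m → Bool
  lonelyClient j   = lonely2 (σ2 j)
  ownCaptured j    = inM (σ2 j) (σO j)
  capturedLonely j = lonelyClient j ∧ ownCaptured j
  freeLonely j     = lonelyClient j ∧ not (ownCaptured j)

  freeLonely⇒unmatched : ∀ j → T (freeLonely j) → ¬ T (matched2 (σ2 j))
  freeLonely⇒unmatched j free = lonely⇒unmatched (σ2 j) (∧-elimˡ (lonelyClient j) free)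

  lonely-opening-cost : lam * toℚ k2L ≤ sumWhere lonelyClient extra
  lonely-opening-cost = begin
    lam * toℚ k2L                                               ≡⟨ cong (lam *_) (countFin-size lonely2) ⟩
    lam * size lonely2                                          ≡⟨ sumWhere-const lonely2 lam ⟨
    sumWhere lonely2 (λ _ → lam)                                ≤⟨ sumWhere-mono-≤ lonely2 gain ⟩
    sumWhere lonely2 (λ f → sumWhere (λ j → σ2 j == f) extra)   ≡⟨ sumWhere-∘ σ2 lonely2 extra ⟨
    sumWhere lonelyClient extra                                 ∎
    where
    open ≤-Reasoning
    gain : ∀ f → T (lonely2 f) → lam ≤ sumWhere (λ j → σ2 j == f) extra
    gain f lonely = closing-gain 0≤lam 1≤Δ localOpt f (lonely⇒∈S2 f lonely)

  extra⁺ : Fin m → ℚ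
  extra⁺ j = extra j + (cost2 j + cost2 j)

  extra⁺-nonNeg : ∀ j → 0ℚ ≤ extra⁺ j
  extra⁺-nonNeg j = +-nonNeg (extra-nonNeg j) (+-nonNeg (cost2-nonNeg j) (cost2-nonNeg j))

  captured-fibre-bound : ∀ f → T (lonely2 f) →
    sumWhere (λ j → (σ2 j == f) ∧ inM f (σO j)) extra ≤ sumWhere (λ j → (σ2 j == f) ∧ not (inM f (σO j))) extra⁺
  captured-fibre-bound f lonely = ≤-trans
    (sumWhere-average F∧X F∧¬X {c = 1ℚ} pair (λ j _ → extra⁺-nonNeg j)
                      (fraction-bound {y = size F∧¬X} {r = 1ℚ} {s = ½} (ℚ.positive⁻¹ ½) refl at-most-half))
    (≤-reflexive (ℚ.*-identityˡ (sumWhere F∧¬X extra⁺)))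
    where
    F X F∧X F∧¬X : Fin m → Bool
    F j    = σ2 j == f
    X j    = inM f (σO j)
    F∧X j  = F j ∧ X j
    F∧¬X j = F j ∧ not (X j)
    pair : ∀ i j → T (F∧X i) → T (F∧¬X j) → extra i ≤ extra⁺ j
    pair i j i∈ j∈ = extra-pair i j (trans (==⇒≡ (∧-elimˡ (F i) i∈)) (sym (==⇒≡ (∧-elimˡ (F j) j∈))))
    at-most-half : size F∧X ≤ ½ * (size F∧X + size F∧¬X)
    at-most-half = begin
      size F∧X                             ≡⟨ sumWhere-cong-pred (λ _ → 1ℚ) (λ j → ∧-comm (F j) (X j)) ⟩
      size (λ j → X j ∧ F j)               ≡⟨ countFin-size (λ j → X j ∧ F j) ⟨
      toℚ (countFin (λ j → X j ∧ F j))     ≤⟨ ¬<ᵇ⇒≥ (lonely⇒not-half-captured f lonely) ⟩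
      ½ * toℚ (countFin F)                 ≡⟨ cong (½ *_) (countFin-size F) ⟩
      ½ * size F                           ≡⟨ cong (½ *_) (sumWhere-split F X (λ _ → 1ℚ)) ⟩
      ½ * (size F∧X + size F∧¬X)           ∎
      where open ≤-Reasoning

  lonely-fibre : ∀ f → sumWhere (λ j → (σ2 j == f) ∧ capturedLonely j) extra
                       ≤ sumWhere (λ j → (σ2 j == f) ∧ freeLonely j) extra⁺
  lonely-fibre f = [ lonely , not-lonely ]′ (toSum (T? (lonely2 f)))
    where
    lonely : T (lonely2 f) → sumWhere (λ j → (σ2 j == f) ∧ capturedLonely j) extra
                             ≤ sumWhere (λ j → (σ2 j == f) ∧ freeLonely j) extra⁺
    lonely f-lonely = begin
      sumWhere (λ j → (σ2 j == f) ∧ capturedLonely j) extra         ≡⟨ at-f (λ g j → inM g (σO j)) extra ⟩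
      sumWhere (λ j → (σ2 j == f) ∧ inM f (σO j)) extra             ≤⟨ captured-fibre-bound f f-lonely ⟩
      sumWhere (λ j → (σ2 j == f) ∧ not (inM f (σO j))) extra⁺      ≡⟨ at-f (λ g j → not (inM g (σO j))) extra⁺ ⟨
      sumWhere (λ j → (σ2 j == f) ∧ freeLonely j) extra⁺            ∎
      where
      open ≤-Reasoning
      at-f : ∀ (Y : Fin p → Fin m → Bool) g → sumWhere (λ j → (σ2 j == f) ∧ (lonely2 (σ2 j) ∧ Y (σ2 j) j)) g
                                               ≡ sumWhere (λ j → (σ2 j == f) ∧ Y f j) g
      at-f Y g = trans (sumWhere-on-fibre σ2 f (λ h j → lonely2 h ∧ Y h j) g)
        (sumWhere-cong-pred g (λ j → cong (λ b → (σ2 j == f) ∧ (b ∧ Y f j)) (Equivalence.to T-≡ f-lonely)))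
    not-lonely : ¬ T (lonely2 f) → sumWhere (λ j → (σ2 j == f) ∧ capturedLonely j) extra
                                   ≤ sumWhere (λ j → (σ2 j == f) ∧ freeLonely j) extra⁺
    not-lonely ¬lonely =
      ≤-trans (≤-reflexive (sumWhere-empty (λ j → (σ2 j == f) ∧ capturedLonely j) off-fibre))
              (sumWhere-nonNeg (λ j → (σ2 j == f) ∧ freeLonely j) (λ j _ → extra⁺-nonNeg j))
      where
      off-fibre : ∀ j → ¬ T ((σ2 j == f) ∧ capturedLonely j)
      off-fibre j j∈ = ¬lonely (subst (T ∘ lonely2) (==⇒≡ {i = σ2 j} {f} (∧-elimˡ (σ2 j == f) j∈))
                                      (∧-elimˡ (lonelyClient j) (∧-elimʳ (σ2 j == f) j∈)))

  lonely-extra-bound : sumWhere lonelyClient extra ≤ sumWhere freeLonely reassign + sumWhere freeLonely reassign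
  lonely-extra-bound = begin
    sumWhere lonelyClient extra
      ≡⟨ sumWhere-split lonelyClient ownCaptured extra ⟩
    sumWhere capturedLonely extra + sumWhere freeLonely extra
      ≤⟨ ℚ.+-monoˡ-≤ (sumWhere freeLonely extra) (sumWhere-fibrewise-≤ σ2 capturedLonely freeLonely lonely-fibre) ⟩
    sumWhere freeLonely extra⁺ + sumWhere freeLonely extra
      ≡⟨ sumWhere-+ freeLonely extra⁺ extra ⟨
    sumWhere freeLonely (λ j → extra⁺ j + extra j)
      ≡⟨ sumWhere-cong freeLonely (λ j → twice (reassign j) (cost2 j)) ⟩
    sumWhere freeLonely (λ j → reassign j + reassign j)
      ≡⟨ sumWhere-+ freeLonely reassign reassign ⟩
    sumWhere freeLonely reassign + sumWhere freeLonely reassign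
      ∎
    where
    open ≤-Reasoning
    twice : ∀ r b → ((r - b) + (b + b)) + (r - b) ≡ r + r
    twice = solve 2 (λ r b → ((r :- b) :+ (b :+ b)) :+ (r :- b) := r :+ r) refl

  optMatched optUnmatched freeToMatched freeToLonely : Fin m → Bool
  optMatched j    = matchedO (σO j)
  optUnmatched j  = not (optMatched j)
  freeToMatched j = freeLonely j ∧ optMatched j
  freeToLonely j  = freeLonely j ∧ optUnmatched j

  matched-fibre-bound : ∀ o → T (matchedO o) →
    sumWhere (λ j → (σO j == o) ∧ freeToMatched j) detour
      ≤ sumWhere (λ j → (σO j == o) ∧ mmClient j) (λ j → ε * pathCost j)
  matched-fibre-bound o matched = begin
    sumWhere P detour
      ≤⟨ sumWhere-average P X {c = ε} pair (λ i _ → pathCost-nonNeg i) |P|≤ε|X| ⟩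
    ε * sumWhere X pathCost
      ≤⟨ *-monoˡ-≤-nonNeg 0≤ε (sumWhere-⊆ X Co∧MM X⊆Co∧MM (λ i _ → pathCost-nonNeg i) (λ _ _ → ≤-refl)) ⟩
    ε * sumWhere Co∧MM pathCost
      ≡⟨ sumWhere-*ˡ Co∧MM ε pathCost ⟨
    sumWhere Co∧MM (λ j → ε * pathCost j)
      ∎
    where
    open ≤-Reasoning
    g : Fin p
    g = proj₁ (matched⇒captured o matched)
    g-matched : T (matched2 g)
    g-matched = proj₁ (proj₂ (matched⇒captured o matched))
    g-captures : T (captures (1ℚ - δ) σ2 g σO o)
    g-captures = proj₂ (proj₂ (matched⇒captured o matched))
    Co G P X Y Co∧MM : Fin m → Bool
    Co j    = σO j == o
    G j     = σ2 j == g
    P j     = Co j ∧ freeToMatched j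
    X j     = Co j ∧ G j
    Y j     = Co j ∧ not (G j)
    Co∧MM j = Co j ∧ mmClient j
    at-o : ∀ j → T (Co j) → σO j ≡ o
    at-o j = ==⇒≡ {i = σO j} {o}
    at-g : ∀ j → T (G j) → σ2 j ≡ g
    at-g j = ==⇒≡ {i = σ2 j} {g}
    P⇒¬G : ∀ j → T (P j) → ¬ T (G j)
    P⇒¬G j j∈P j∈G = freeLonely⇒unmatched j (∧-elimˡ (freeLonely j) (∧-elimʳ (Co j) j∈P))
                       (subst (T ∘ matched2) (sym (at-g j j∈G)) g-matched)
    pair : ∀ j i → T (P j) → T (X i) → detour j ≤ pathCost i
    pair j i j∈P i∈X = detour-bound j i
      (trans (at-o i (∧-elimˡ (Co i) i∈X)) (sym (at-o j (∧-elimˡ (Co j) j∈P))))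
      (λ σ2i≡σ2j → P⇒¬G j j∈P (≡⇒== (trans (sym σ2i≡σ2j) (at-g i (∧-elimʳ (Co i) i∈X)))))
    X⊆Co∧MM : ∀ i → T (X i) → T (Co∧MM i)
    X⊆Co∧MM i i∈X = ∧-intro (Co i) i∈Co (∧-intro (matched2 (σ2 i))
        (subst (T ∘ matched2) (sym (at-g i (∧-elimʳ (Co i) i∈X))) g-matched)
        (subst (T ∘ matchedO) (sym (at-o i i∈Co)) matched))
      where
      i∈Co = ∧-elimˡ (Co i) i∈X
    mostly-at-g : size Y ≤ δ * (size Y + size X)
    mostly-at-g = ≤-by-gap _ (p≤q⇒0≤q-p captured) (gap δ (size X) (size Y))
      where
      captured : (1ℚ - δ) * (size X + size Y) ≤ size X
      captured = begin
        (1ℚ - δ) * (size X + size Y)        ≡⟨ cong ((1ℚ - δ) *_) (sumWhere-split Co G (λ _ → 1ℚ)) ⟨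
        (1ℚ - δ) * size Co                  ≡⟨ cong ((1ℚ - δ) *_) (countFin-size Co) ⟨
        (1ℚ - δ) * toℚ (countFin Co)        ≤⟨ <⇒≤ (<ᵇ⇒< g-captures) ⟩
        toℚ (countFin (λ j → G j ∧ Co j))   ≡⟨ countFin-size (λ j → G j ∧ Co j) ⟩
        size (λ j → G j ∧ Co j)             ≡⟨ sumWhere-cong-pred (λ _ → 1ℚ) (λ j → ∧-comm (G j) (Co j)) ⟩
        size X                              ∎
      gap : ∀ δ x y → x - (1ℚ - δ) * (x + y) ≡ δ * (y + x) - y
      gap = solve 3 (λ δ x y → x :- (con 1ℚ :- δ) :* (x :+ y) := δ :* (y :+ x) :- y) refl
    |P|≤ε|X| : size P ≤ ε * size X
    |P|≤ε|X| = ≤-trans (sumWhere-⊆ P Y (λ j j∈P → ∧-intro (Co j) (∧-elimˡ (Co j) j∈P) (T-not⁺ (P⇒¬G j j∈P)))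
                                   (λ _ _ → 0≤1) (λ _ _ → ≤-refl))
                       (fraction-bound {r = ε} {s = δ} 0<1-δ ε[1-δ]≡δ mostly-at-g)

  matched-fibre : ∀ o → sumWhere (λ j → (σO j == o) ∧ freeToMatched j) detour
                        ≤ sumWhere (λ j → (σO j == o) ∧ mmClient j) (λ j → ε * pathCost j)
  matched-fibre o = [ matched-fibre-bound o , unmatched ]′ (toSum (T? (matchedO o)))
    where
    unmatched : ¬ T (matchedO o) → sumWhere (λ j → (σO j == o) ∧ freeToMatched j) detour
                                    ≤ sumWhere (λ j → (σO j == o) ∧ mmClient j) (λ j → ε * pathCost j)
    unmatched ¬matched =
      ≤-trans (≤-reflexive (sumWhere-empty (λ j → (σO j == o) ∧ freeToMatched j) off-fibre))
              (sumWhere-nonNeg (λ j → (σO j == o) ∧ mmClient j) (λ j _ → *-nonNeg 0≤ε (pathCost-nonNeg j)))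
      where
      off-fibre : ∀ j → ¬ T ((σO j == o) ∧ freeToMatched j)
      off-fibre j j∈ = ¬matched (subst (T ∘ matchedO) (==⇒≡ {i = σO j} {o} (∧-elimˡ (σO j == o) j∈))
                                       (∧-elimʳ (freeLonely j) (∧-elimʳ (σO j == o) j∈)))

  -- Free clients of o not at σ2 js are sent via
  -- js (P₁-bound); those at σ2 js are averaged over the clients Q of o elsewhere (P₂-cross),
  -- which are numerous because σ2 js does not (1-δ)-capture o (|I|≤K|Q|).
  module UnmatchedFibre (o : Fin p) (j₀ : Fin m) (j₀∈o : T (σO j₀ == o)) where

    Co : Fin m → Bool
    Co j = σO j == o

    js : Fin m
    js = argminOn (λ j → T? (Co j)) pathCost j₀

    js∈o : T (Co js)
    js∈o = argminOn-satisfies (λ j → T? (Co j)) pathCost j₀∈o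

    js-cheapest : ∀ j → T (Co j) → pathCost js ≤ pathCost j
    js-cheapest j = argminOn-minimal (λ j → T? (Co j)) pathCost j₀

    a : ℚ
    a = pathCost js

    Fs P P₁ P₂ I Q : Fin m → Bool
    Fs j = σ2 j == σ2 js
    P j  = Co j ∧ freeToLonely j
    P₂ j = P j ∧ Fs j
    P₁ j = P j ∧ not (Fs j)
    I j  = Co j ∧ Fs j
    Q j  = Co j ∧ not (Fs j)

    at-o : ∀ j → T (Co j) → σO j ≡ o
    at-o j = ==⇒≡ {i = σO j} {o}

    at-fs : ∀ j → T (Fs j) → σ2 j ≡ σ2 js
    at-fs j = ==⇒≡ {i = σ2 j} {σ2 js}

    P⇒Co : ∀ j → T (P j) → T (Co j)
    P⇒Co j = ∧-elimˡ (Co j)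

    same-opt : ∀ j i → T (Co j) → T (Co i) → σO i ≡ σO j
    same-opt j i j∈o i∈o = trans (at-o i i∈o) (sym (at-o j j∈o))

    P₁-bound : sumWhere P₁ detour ≤ a * size Q
    P₁-bound = ≤-trans (sumWhere-⊆ P₁ Q P₁⊆Q (λ _ _ → pathCost-nonNeg js) via-js) (≤-reflexive (sumWhere-const Q a))
      where
      P₁⊆Q : ∀ j → T (P₁ j) → T (Q j)
      P₁⊆Q j j∈ = ∧-intro (Co j) (P⇒Co j (∧-elimˡ (P j) j∈)) (∧-elimʳ (P j) j∈)
      via-js : ∀ j → T (P₁ j) → detour j ≤ a
      via-js j j∈ = detour-bound j js (same-opt j js (P⇒Co j (∧-elimˡ (P j) j∈)) js∈o)
                      (λ σ2js≡σ2j → T-not⁻ (∧-elimʳ (P j) j∈) (≡⇒== (sym σ2js≡σ2j)))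

    P₂-cross : sumWhere P₂ detour * size Q ≤ size P₂ * sumWhere Q pathCost
    P₂-cross = sumWhere-cross P₂ Q (λ j i j∈ i∈ → detour-bound j i
      (same-opt j i (P⇒Co j (∧-elimˡ (P j) j∈)) (∧-elimˡ (Co i) i∈))
      (λ σ2i≡σ2j → T-not⁻ (∧-elimʳ (Co i) i∈) (≡⇒== (trans σ2i≡σ2j (at-fs j (∧-elimʳ (P j) j∈))))))

    P₂⊆I : ∀ i → T (P₂ i) → T (I i)
    P₂⊆I i i∈ = ∧-intro (Co i) (P⇒Co i (∧-elimˡ (P i) i∈)) (∧-elimʳ (P i) i∈)

    a|Q|≤ : a * size Q ≤ sumWhere Q pathCost
    a|Q|≤ = size-≤-sumWhere Q (λ i i∈ → js-cheapest i (∧-elimˡ (Co i) i∈))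

    a|P₂|≤ : a * size P₂ ≤ sumWhere I pathCost
    a|P₂|≤ = ≤-trans (size-≤-sumWhere P₂ (λ i i∈ → js-cheapest i (P⇒Co i (∧-elimˡ (P i) i∈))))
                     (sumWhere-⊆ P₂ I P₂⊆I (λ i _ → pathCost-nonNeg i) (λ _ _ → ≤-refl))

    |I|≤K|Q| : ∀ j₂ → T (P₂ j₂) → size I ≤ K * size Q
    |I|≤K|Q| j₂ j₂∈ = fraction-bound {r = K} {s = 1ℚ - δ} 0<1-[1-δ] K[1-[1-δ]]≡1-δ not-captured
      where
      j₂∈P = ∧-elimˡ (P j₂) j₂∈
      σO-j₂ : σO j₂ ≡ o
      σO-j₂ = at-o j₂ (P⇒Co j₂ j₂∈P)
      ¬inM : ¬ T (inM (σ2 js) o)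
      ¬inM = subst₂ (λ f o′ → ¬ T (inM f o′)) (at-fs j₂ (∧-elimʳ (P j₂) j₂∈)) σO-j₂
               (T-not⁻ (∧-elimʳ (lonelyClient j₂) (∧-elimˡ (freeLonely j₂) (∧-elimʳ (Co j₂) j₂∈P))))
      not-captured : size I ≤ (1ℚ - δ) * (size I + size Q)
      not-captured = begin
        size I                               ≡⟨ sumWhere-cong-pred (λ _ → 1ℚ) (λ j → ∧-comm (Co j) (Fs j)) ⟩
        size (λ j → Fs j ∧ Co j)             ≡⟨ countFin-size (λ j → Fs j ∧ Co j) ⟨
        toℚ (countFin (λ j → Fs j ∧ Co j))   ≤⟨ ¬<ᵇ⇒≥ (not-inM⇒not-captured (σ2 js) o
                                                    (subst (_∈ OPT) σO-j₂ (σO∈OPT j₂)) ¬inM) ⟩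
        (1ℚ - δ) * toℚ (countFin Co)         ≡⟨ cong ((1ℚ - δ) *_) (countFin-size Co) ⟩
        (1ℚ - δ) * size Co                   ≡⟨ cong ((1ℚ - δ) *_) (sumWhere-split Co Fs (λ _ → 1ℚ)) ⟩
        (1ℚ - δ) * (size I + size Q)         ∎
        where open ≤-Reasoning
      1-[1-δ]≡δ : 1ℚ - (1ℚ - δ) ≡ δ
      1-[1-δ]≡δ = solve 1 (λ δ → con 1ℚ :- (con 1ℚ :- δ) := δ) refl δ
      0<1-[1-δ] : 0ℚ < 1ℚ - (1ℚ - δ)
      0<1-[1-δ] = subst (0ℚ <_) (sym 1-[1-δ]≡δ) 0<δ
      K[1-[1-δ]]≡1-δ : K * (1ℚ - (1ℚ - δ)) ≡ 1ℚ - δ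
      K[1-[1-δ]]≡1-δ = trans (cong (K *_) 1-[1-δ]≡δ) Kδ≡1-δ

    |P₂|≤K|Q| : size P₂ ≤ K * size Q
    |P₂|≤K|Q| = [ some-P₂ , no-P₂ ]′ (toSum (Fin.any? (λ j → T? (P₂ j))))
      where
      some-P₂ : ∃[ j₂ ] T (P₂ j₂) → size P₂ ≤ K * size Q
      some-P₂ (j₂ , j₂∈) = ≤-trans (sumWhere-⊆ P₂ I P₂⊆I (λ _ _ → 0≤1) (λ _ _ → ≤-refl)) (|I|≤K|Q| j₂ j₂∈)
      no-P₂ : ¬ (∃[ j₂ ] T (P₂ j₂)) → size P₂ ≤ K * size Q
      no-P₂ none = ≤-trans (≤-reflexive (sumWhere-empty P₂ {λ _ → 1ℚ} (λ j j∈ → none (j , j∈))))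
                           (*-nonNeg 0≤K (size-nonNeg Q))

    bound : sumWhere P detour ≤ K * sumWhere Co pathCost
    bound = [ Q-empty , Q-nonempty ]′ (toSum (size Q ℚ.≤? 0ℚ))
      where
      Q-empty : size Q ≤ 0ℚ → sumWhere P detour ≤ K * sumWhere Co pathCost
      Q-empty |Q|≤0 = ≤-trans (≤-reflexive (sumWhere-empty P {detour} P-empty))
                              (*-nonNeg 0≤K (sumWhere-nonNeg Co (λ j _ → pathCost-nonNeg j)))
        where
        |P₂|≤0 : size P₂ ≤ 0ℚ
        |P₂|≤0 = ≤-trans |P₂|≤K|Q| (≤-trans (*-monoˡ-≤-nonNeg 0≤K |Q|≤0) (≤-reflexive (ℚ.*-zeroʳ K)))
        P-empty : ∀ j → ¬ T (P j)
        P-empty j j∈ = [ (λ at-fs  → size≤0⇒empty P₂ |P₂|≤0 j (∧-intro (P j) j∈ at-fs))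
                       , (λ off-fs → size≤0⇒empty Q |Q|≤0 j (∧-intro (Co j) (P⇒Co j j∈) (T-not⁺ off-fs)))
                       ]′ (toSum (T? (Fs j)))
      Q-nonempty : ¬ (size Q ≤ 0ℚ) → sumWhere P detour ≤ K * sumWhere Co pathCost
      Q-nonempty |Q|≰0 = begin
        sumWhere P detour
          ≡⟨ sumWhere-split P Fs detour ⟩
        sumWhere P₂ detour + sumWhere P₁ detour
          ≤⟨ min-avg-bound {L₂ = sumWhere P₂ detour} 1≤K (pathCost-nonNeg js) (size-nonNeg P₂) (≰⇒> |Q|≰0)
                           P₁-bound P₂-cross a|Q|≤ a|P₂|≤ |P₂|≤K|Q| ⟩
        K * (sumWhere I pathCost + sumWhere Q pathCost)
          ≡⟨ cong (K *_) (sumWhere-split Co Fs pathCost) ⟨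
        K * sumWhere Co pathCost
          ∎
        where open ≤-Reasoning

  unmatched-fibre : ∀ o → sumWhere (λ j → (σO j == o) ∧ freeToLonely j) detour
                          ≤ sumWhere (λ j → (σO j == o) ∧ optUnmatched j) (λ j → K * pathCost j)
  unmatched-fibre o = [ some-free , no-free ]′ (toSum (Fin.any? (λ j → T? (P j))))
    where
    Co P Co∧U : Fin m → Bool
    Co j   = σO j == o
    P j    = Co j ∧ freeToLonely j
    Co∧U j = Co j ∧ optUnmatched j
    some-free : ∃[ j₀ ] T (P j₀) → sumWhere P detour ≤ sumWhere Co∧U (λ j → K * pathCost j)
    some-free (j₀ , j₀∈) = begin
      sumWhere P detour                       ≤⟨ UnmatchedFibre.bound o j₀ j₀∈o ⟩
      K * sumWhere Co pathCost                ≡⟨ cong (K *_) (sumWhere-∧-redundant Co optUnmatched pathCost Co⇒U) ⟨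
      K * sumWhere Co∧U pathCost              ≡⟨ sumWhere-*ˡ Co∧U K pathCost ⟨
      sumWhere Co∧U (λ j → K * pathCost j)    ∎
      where
      open ≤-Reasoning
      j₀∈o : T (Co j₀)
      j₀∈o = ∧-elimˡ (Co j₀) j₀∈
      o-unmatched : ¬ T (matchedO o)
      o-unmatched = subst (λ o′ → ¬ T (matchedO o′)) (==⇒≡ {i = σO j₀} {o} j₀∈o)
                          (T-not⁻ (∧-elimʳ (freeLonely j₀) (∧-elimʳ (Co j₀) j₀∈)))
      Co⇒U : ∀ j → T (Co j) → T (optUnmatched j)
      Co⇒U j j∈o = T-not⁺ (subst (λ o′ → ¬ T (matchedO o′)) (sym (==⇒≡ {i = σO j} {o} j∈o)) o-unmatched)
    no-free : ¬ (∃[ j₀ ] T (P j₀)) → sumWhere P detour ≤ sumWhere Co∧U (λ j → K * pathCost j)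
    no-free none = ≤-trans (≤-reflexive (sumWhere-empty P {detour} (λ j j∈ → none (j , j∈))))
                           (sumWhere-nonNeg Co∧U (λ j _ → *-nonNeg 0≤K (pathCost-nonNeg j)))

  notMM : Fin m → Bool
  notMM j = not (mmClient j)

  freeCostBound : ℚ
  freeCostBound = sumWhere notMM costO + (ε * sumWhere mmClient pathCost + K * sumWhere notMM pathCost)

  free-reassign-bound : sumWhere freeLonely reassign ≤ freeCostBound
  free-reassign-bound = begin
    sumWhere freeLonely reassign
      ≡⟨ sumWhere-cong freeLonely (λ j → reassign≡costO+detour (reassign j) (costO j)) ⟩
    sumWhere freeLonely (λ j → costO j + detour j)
      ≡⟨ sumWhere-+ freeLonely costO detour ⟩
    sumWhere freeLonely costO + sumWhere freeLonely detour
      ≡⟨ cong (sumWhere freeLonely costO +_) (sumWhere-split freeLonely optMatched detour) ⟩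
    sumWhere freeLonely costO + (sumWhere freeToMatched detour + sumWhere freeToLonely detour)
      ≤⟨ +-mono-≤ (sumWhere-⊆ freeLonely notMM free⇒notMM (λ j _ → costO-nonNeg j) (λ _ _ → ≤-refl))
                  (+-mono-≤ to-matched to-lonely) ⟩
    freeCostBound
      ∎
    where
    open ≤-Reasoning
    reassign≡costO+detour : ∀ r c → r ≡ c + (r - c)
    reassign≡costO+detour = solve 2 (λ r c → r := c :+ (r :- c)) refl
    free⇒notMM : ∀ j → T (freeLonely j) → T (notMM j)
    free⇒notMM j free = T-not⁺ (λ mm → freeLonely⇒unmatched j free (∧-elimˡ (matched2 (σ2 j)) mm))
    U⇒notMM : ∀ j → T (optUnmatched j) → T (notMM j)
    U⇒notMM j unmatched = T-not⁺ (λ mm → T-not⁻ unmatched (∧-elimʳ (matched2 (σ2 j)) mm))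
    to-matched : sumWhere freeToMatched detour ≤ ε * sumWhere mmClient pathCost
    to-matched = ≤-trans (sumWhere-fibrewise-≤ σO freeToMatched mmClient matched-fibre)
                         (≤-reflexive (sumWhere-*ˡ mmClient ε pathCost))
    to-lonely : sumWhere freeToLonely detour ≤ K * sumWhere notMM pathCost
    to-lonely = begin
      sumWhere freeToLonely detour
        ≤⟨ sumWhere-fibrewise-≤ σO freeToLonely optUnmatched unmatched-fibre ⟩
      sumWhere optUnmatched (λ j → K * pathCost j)
        ≡⟨ sumWhere-*ˡ optUnmatched K pathCost ⟩
      K * sumWhere optUnmatched pathCost
        ≤⟨ *-monoˡ-≤-nonNeg 0≤K (sumWhere-⊆ optUnmatched notMM U⇒notMM (λ j _ → pathCost-nonNeg j) (λ _ _ → ≤-refl)) ⟩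
      K * sumWhere notMM pathCost
        ∎

  doubled-bound≡statement :
    freeCostBound + freeCostBound
      ≡ ((toℚ 2 /ℚ δ) * (1ℚ - optMM /ℚ connCost σO)
         + (toℚ 2 * K) * (connCost σ2 /ℚ connCost σO - d2MM /ℚ connCost σO)
         + (toℚ 2 * ε) * (d2MM /ℚ connCost σO + optMM /ℚ connCost σO)) * connCost σO
  doubled-bound≡statement = begin
    freeCostBound + freeCostBound
      ≡⟨ cong₂ (λ u w → X u w + X u w) (sumWhere-+ mmClient costO cost2) (sumWhere-+ notMM costO cost2) ⟩
    X (optMM + d2MM) (NA + NB) + X (optMM + d2MM) (NA + NB)
      ≡⟨ bound-identity {toℚ 2 /ℚ δ} {K} {ε} {connCost σO} {optMM} {connCost σ2} {d2MM} {NA} {NB}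
                        (ℚ.<⇒≢ 0<opt ∘ sym) 2/δ≡2+2K
                        (sumWhere-split (λ _ → true) mmClient costO) (sumWhere-split (λ _ → true) mmClient cost2) ⟨
    ((toℚ 2 /ℚ δ) * (1ℚ - optMM /ℚ connCost σO)
      + (toℚ 2 * K) * (connCost σ2 /ℚ connCost σO - d2MM /ℚ connCost σO)
      + (toℚ 2 * ε) * (d2MM /ℚ connCost σO + optMM /ℚ connCost σO)) * connCost σO ∎
    where
    open ≡-Reasoning
    NA NB : ℚ
    NA = sumWhere notMM costO
    NB = sumWhere notMM cost2
    X : ℚ → ℚ → ℚ
    X u w = NA + (ε * u + K * w)

lemma4p2 : ∀ {m p : ℕ} (dist : Point m p → Point m p → ℚ) → IsMetric dist →
    (k : ℕ) (OPT : Subset p) (σO : Fin m → Fin p) →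
    Instance.KMedianOpt dist k OPT σO →
    (lam δ : ℚ) → 0ℚ ≤ lam → 0ℚ < δ → δ ≤ ½ →
    (Δ : ℕ) → 1 ≤ℕ Δ →
    (S2 : Subset p) (σ2 : Fin m → Fin p) → Instance.Closest dist S2 σ2 →
    k <ℕ ∣ S2 ∣ →
    Instance.LocalOpt dist Δ lam S2 σ2 →
    0ℚ < Instance.connCost dist σO →
    let open Instance dist
        open Matching δ OPT σO S2 σ2
        opt  = connCost σO
        d2   = connCost σ2
        αMM  = optMM /ℚ opt
        β2   = d2 /ℚ opt
        β2MM = d2MM /ℚ opt
        two  = toℚ 2
    in lam * toℚ k2L ≤
         ((two /ℚ δ) * (1ℚ - αMM)
          + (two * ((1ℚ - δ) /ℚ δ)) * (β2 - β2MM)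
          + (two * (δ /ℚ (1ℚ - δ))) * (β2MM + αMM)) * opt
lemma4p2 dist metric k OPT σO optimal lam δ 0≤lam 0<δ δ≤½ Δ 1≤Δ S2 σ2 closest2 k<∣S2∣ localOpt 0<opt = begin
  lam * toℚ k2L                                                ≤⟨ lonely-opening-cost ⟩
  sumWhere lonelyClient extra                                  ≤⟨ lonely-extra-bound ⟩
  sumWhere freeLonely reassign + sumWhere freeLonely reassign  ≤⟨ +-mono-≤ free-reassign-bound free-reassign-bound ⟩
  freeCostBound + freeCostBound                                ≡⟨ doubled-bound≡statement ⟩
  _                                                            ∎
  where
  open Instance.Matching dist δ OPT σO S2 σ2 using (k2L)
  open Analysis dist metric k OPT σO optimal lam δ 0≤lam 0<δ δ≤½ Δ 1≤Δ S2 σ2 closest2 k<∣S2∣ localOpt 0<opt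
  open ≤-Reasoning
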